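{- Let $n\ge2$. For $G,G'\in\mathscr{F}_{n,3}$ write $G\preceq G'$ if $G'$ can be obtained from $G$ by a finite (possibly empty) sequence of interchange operations. Then $\preceq$ is a partial order on $\mathscr{F}_{n,3}$, and $\mathbf{b}\mapsto G_{\mathbf{b}}$ is an isomorphism from the Boolean poset $\{0,1\}^{n-2}$ (ordered componentwise) onto $(\mathscr{F}_{n,3},\preceq)$.
   Context: DAGs have vertex set $[n+1]$ and a multiset of edges $(i,j)$ with $i<j$ (parallel edges allowed), identified with their edge multisets. $\mathscr{F}_{n,3}$ is the set of such DAGs with out-degree sequence $(3,2,\dots,2,0)$ and in-degree sequence $(0,2,\dots,2,3)$. For a nested pair of edges $(a,d),(b,c)$ with $a<b<c<d$, the interchange operation replaces them by $(a,c),(b,d)$. For $\mathbf{b}=b_1\cdots b_{n-2}\in\{0,1\}^{n-2}$ with $\{i:b_i=1\}=\{j_1<\dots<j_r\}$, $G_{\mathbf{b}}$ has edge multiset: $(i,i+1)$ for $i\in[n]$; extra copies of $(1,2)$ and $(n,n+1)$; an extra copy of $(l+1,l+2)$ for each $l$ with $b_l=0$; and $(1,j_1+2),(j_1+1,j_2+2),\dots,(j_{r-1}+1,j_r+2),(j_r+1,n+1)$ (just $(1,n+1)$ if $r=0$). -}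

module Defs where

open import Data.Nat using (ℕ; zero; suc; _+_; _≤_; _<_; _≡ᵇ_)
open import Data.Bool using (Bool; true; false; if_then_else_; _∧_)
open import Data.Fin using (Fin; toℕ)
import Data.Fin as Fin
open import Data.List using (List; []; _∷_; _++_; map; upTo)
open import Data.Vec using (Vec; lookup; tabulate; toList)
import Data.Vec as Vec
open import Data.Product using (_×_; _,_; ∃-syntax)
open import Relation.Binary.PropositionalEquality using (_≡_)
open import Relation.Binary.Construct.Closure.ReflexiveTransitive using (Star)

-- Vertex k : Fin (suc n) stands for the paper's vertex k+1.
-- A multigraph is its edge multiset, stored canonically as the
-- multiplicity matrix: entry (i , j) = number of copies of edge (i+1 , j+1).

Graph : ℕ → Set
Graph n = Vec (Vec ℕ (suc n)) (suc n)

mult : ∀ {n} → Graph n → Fin (suc n) → Fin (suc n) → ℕ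
mult G i j = lookup (lookup G i) j

sumV : ∀ {m} → Vec ℕ m → ℕ
sumV = Vec.foldr _ _+_ 0

outdeg : ∀ {n} → Graph n → Fin (suc n) → ℕ
outdeg G i = sumV (lookup G i)

indeg : ∀ {n} → Graph n → Fin (suc n) → ℕ
indeg G j = sumV (Vec.map (λ row → lookup row j) G)

outSpec : (n : ℕ) → Fin (suc n) → ℕ
outSpec n k = if toℕ k ≡ᵇ 0 then 3 else (if toℕ k ≡ᵇ n then 0 else 2)

inSpec : (n : ℕ) → Fin (suc n) → ℕ
inSpec n k = if toℕ k ≡ᵇ 0 then 0 else (if toℕ k ≡ᵇ n then 3 else 2)

InF : (n : ℕ) → Graph n → Set
InF n G = (∀ i j → toℕ j ≤ toℕ i → mult G i j ≡ 0)
        × (∀ i → outdeg G i ≡ outSpec n i)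
        × (∀ i → indeg G i ≡ inSpec n i)

-- Interchange: for a < b < c < d, replace one copy each of (a,d),(b,c)
-- by one copy each of (a,c),(b,d).

isPair : ∀ {n} → Fin n → Fin n → Fin n → Fin n → ℕ
isPair i j x y = if (toℕ i ≡ᵇ toℕ x) ∧ (toℕ j ≡ᵇ toℕ y) then 1 else 0

Interchange : ∀ {n} → Graph n → Graph n → Set
Interchange {n} G G' =
  ∃[ a ] ∃[ b ] ∃[ c ] ∃[ d ]
    (a Fin.< b × b Fin.< c × c Fin.< d ×
     1 ≤ mult G a d × 1 ≤ mult G b c ×
     (∀ i j → mult G' i j + isPair i j a d + isPair i j b c
              ≡ mult G i j + isPair i j a c + isPair i j b d))

_⪯_ : ∀ {n} → Graph n → Graph n → Set
_⪯_ = Star Interchange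

-- The graphs G_b, written with the paper's 1-based vertex labels.

countE : ℕ → ℕ → List (ℕ × ℕ) → ℕ
countE u v [] = 0
countE u v ((x , y) ∷ es) = (if (u ≡ᵇ x) ∧ (v ≡ᵇ y) then 1 else 0) + countE u v es

-- chain p l bs n : p = tail vertex of the next chain edge, l = index of head of bs
chainEdges : ℕ → ℕ → List Bool → ℕ → List (ℕ × ℕ)
chainEdges p l [] n = (p , suc n) ∷ []
chainEdges p l (true ∷ bs) n = (p , l + 2) ∷ chainEdges (l + 1) (suc l) bs n
chainEdges p l (false ∷ bs) n = chainEdges p (suc l) bs n

zeroEdges : ℕ → List Bool → List (ℕ × ℕ)
zeroEdges l [] = []
zeroEdges l (true ∷ bs) = zeroEdges (suc l) bs
zeroEdges l (false ∷ bs) = (l + 1 , l + 2) ∷ zeroEdges (suc l) bs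

edgesG : (n : ℕ) → List Bool → List (ℕ × ℕ)
edgesG n bs =
  map (λ k → (suc k , k + 2)) (upTo n)
  ++ (1 , 2) ∷ (n , suc n) ∷ []
  ++ zeroEdges 1 bs
  ++ chainEdges 1 1 bs n

G[_] : ∀ {n} → Vec Bool (n Data.Nat.∸ 2) → Graph n
G[_] {n} b = tabulate λ i → tabulate λ j →
  countE (suc (toℕ i)) (suc (toℕ j)) (edgesG n (toList b))

-- A member of 𝓕_{n,3} is determined by its superdiagonal, the multiplicities of the edges
-- (i, i+1): merging the vertices 1 and 2 gives a member of 𝓕_{n-1,3}, from which the graph is
-- recovered once the multiplicity of (2,3) is known, so this follows by induction on n, as does
-- the shape of the superdiagonal (2 at both ends, 1 or 2 in between).  G_b has superdiagonal
-- (2, 2 − b_1, …, 2 − b_{n−2}, 2), hence b ↦ G_b is a bijection onto 𝓕_{n,3}.  An interchange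
-- never increases a superdiagonal entry, which gives antisymmetry of ⪯ and shows that G_b ⪯ G_b′
-- forces b ≤ b′.  Conversely, raising one bit b_l from 0 to 1 is a single interchange: the doubled
-- edge (l+1, l+2) of G_b is nested in some other edge, and the interchange of the two yields a
-- member of 𝓕_{n,3} with the superdiagonal of the raised vector.

module Submission where

open import Data.Bool using (Bool; true; false; if_then_else_; _∧_)
import Data.Bool as B
open import Data.Bool.Properties using (∧-idem; ∧-zeroʳ; ∧-identityʳ)
open import Data.Empty using (⊥-elim)
open import Defs
open import Data.Nat using (ℕ; zero; suc; _+_; _∸_; _≤_; _<_; z≤n; s≤s; _≡ᵇ_; _≟_)
open import Data.Nat.Properties
open import Algebra.Properties.CommutativeSemigroup +-commutativeSemigroup using (interchange; xy∙z≈xz∙y; x∙yz≈y∙xz)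
open import Data.Product using (_×_; _,_; ∃-syntax; proj₁; proj₂)
open import Data.Sum using (_⊎_; inj₁; inj₂)
import Data.Sum as Sum
open import Data.Fin using (Fin; toℕ; fromℕ<)
import Data.Fin as Fin
open import Data.Fin.Properties using (toℕ≤pred[n]; toℕ-fromℕ<)
open import Data.List using (List; []; _∷_; _++_; map; upTo; applyUpTo)
open import Data.List.Relation.Unary.All using (All; []; _∷_)
open import Data.List.Relation.Unary.All.Properties using (++⁺; map⁺; applyUpTo⁺₁)
open import Data.Vec using (Vec; []; _∷_; lookup; tabulate; toList)
import Data.Vec as Vec
open import Data.Vec.Relation.Binary.Pointwise.Inductive using (Pointwise; []; _∷_)
open import Function using (_∘_)
open import Function.Bundles using (_⇔_; mk⇔)
open import Relation.Binary.PropositionalEquality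
open import Relation.Nullary using (¬_; yes; no)
open import Relation.Nullary.Decidable using (dec-true; dec-false)
open import Relation.Binary.Construct.Closure.ReflexiveTransitive using (Star; ε; _◅_; _◅◅_; gmap)

-- Finite sums and indicators

∑ : ℕ → (ℕ → ℕ) → ℕ
∑ zero    f = 0
∑ (suc m) f = f 0 + ∑ m (f ∘ suc)

∑-cong : ∀ m {f g : ℕ → ℕ} → (∀ j → j < m → f j ≡ g j) → ∑ m f ≡ ∑ m g
∑-cong zero    f≗g = refl
∑-cong (suc m) f≗g = cong₂ _+_ (f≗g 0 (s≤s z≤n)) (∑-cong m (λ j j<m → f≗g (suc j) (s≤s j<m)))

∑-zero : ∀ m {f : ℕ → ℕ} → (∀ j → j < m → f j ≡ 0) → ∑ m f ≡ 0
∑-zero zero    f≗0 = refl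
∑-zero (suc m) f≗0 = cong₂ _+_ (f≗0 0 (s≤s z≤n)) (∑-zero m (λ j j<m → f≗0 (suc j) (s≤s j<m)))

∑-distrib-+ : ∀ m (f g : ℕ → ℕ) → ∑ m (λ j → f j + g j) ≡ ∑ m f + ∑ m g
∑-distrib-+ zero    f g = refl
∑-distrib-+ (suc m) f g = begin
  f 0 + g 0 + ∑ m (λ j → f (suc j) + g (suc j))   ≡⟨ cong (f 0 + g 0 +_) (∑-distrib-+ m (f ∘ suc) (g ∘ suc)) ⟩
  f 0 + g 0 + (∑ m (f ∘ suc) + ∑ m (g ∘ suc))     ≡⟨ interchange (f 0) (g 0) _ _ ⟩
  f 0 + ∑ m (f ∘ suc) + (g 0 + ∑ m (g ∘ suc))     ∎
  where open ≡-Reasoning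

∑≡0⇒ : ∀ m (f : ℕ → ℕ) → ∑ m f ≡ 0 → ∀ j → j < m → f j ≡ 0
∑≡0⇒ (suc m) f ∑≡0 zero    _         = m+n≡0⇒m≡0 (f 0) ∑≡0
∑≡0⇒ (suc m) f ∑≡0 (suc j) (s≤s j<m) = ∑≡0⇒ m (f ∘ suc) (m+n≡0⇒n≡0 (f 0) ∑≡0) j j<m

1≤∑⇒ : ∀ m (f : ℕ → ℕ) → 1 ≤ ∑ m f → ∃[ j ] (j < m × 1 ≤ f j)
1≤∑⇒ (suc m) f 1≤∑ with f 0 in f0≡
... | suc _ = 0 , s≤s z≤n , subst (1 ≤_) (sym f0≡) (s≤s z≤n)
... | zero with 1≤∑⇒ m (f ∘ suc) 1≤∑
...   | j , j<m , 1≤fj = suc j , s≤s j<m , 1≤fj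

-- Written as in Defs, so that the edge counts there unfold to ⟦_⟧.
⟦_⟧ : Bool → ℕ
⟦ b ⟧ = if b then 1 else 0

≡ᵇ-refl : ∀ n → (n ≡ᵇ n) ≡ true
≡ᵇ-refl n = dec-true (n ≟ n) refl

≢⇒≡ᵇ≡false : ∀ {m n} → ¬ m ≡ n → (m ≡ᵇ n) ≡ false
≢⇒≡ᵇ≡false {m} {n} = dec-false (m ≟ n)

∑-≡ᵇ : ∀ m y → y < m → ∑ m (λ j → ⟦ j ≡ᵇ y ⟧) ≡ 1
∑-≡ᵇ (suc m) zero    _         = cong suc (∑-zero m (λ _ _ → refl))
∑-≡ᵇ (suc m) (suc y) (s≤s y<m) = ∑-≡ᵇ m y y<m

-- Multiplicity matrices of 𝓕_{n,3} and their contraction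

Matrix : Set
Matrix = ℕ → ℕ → ℕ

outSpecℕ : ℕ → ℕ → ℕ
outSpecℕ n k = if k ≡ᵇ 0 then 3 else (if k ≡ᵇ n then 0 else 2)

inSpecℕ : ℕ → ℕ → ℕ
inSpecℕ n k = if k ≡ᵇ 0 then 0 else (if k ≡ᵇ n then 3 else 2)

-- A member of 𝓕_{n,3} as a multiplicity matrix on the vertices 0 … n (the paper's 1 … n+1);
-- entries outside that range are irrelevant.
record InFᴹ (n : ℕ) (M : Matrix) : Set where
  field
    upper  : ∀ i j → i ≤ n → j ≤ n → j ≤ i → M i j ≡ 0
    rowSum : ∀ i → i ≤ n → ∑ (suc n) (M i) ≡ outSpecℕ n i
    colSum : ∀ j → j ≤ n → ∑ (suc n) (λ i → M i j) ≡ inSpecℕ n j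

_≈[_]_ : Matrix → ℕ → Matrix → Set
M ≈[ n ] M′ = ∀ i j → i ≤ n → j ≤ n → M i j ≡ M′ i j

SameSuperdiagonal : ℕ → Matrix → Matrix → Set
SameSuperdiagonal n M M′ = ∀ i → i < n → M i (suc i) ≡ M′ i (suc i)

InFᴹ-resp : ∀ {n M M′} → M ≈[ n ] M′ → InFᴹ n M → InFᴹ n M′
InFᴹ-resp {n} M≈M′ F = record
  { upper  = λ i j i≤n j≤n j≤i → trans (sym (M≈M′ i j i≤n j≤n)) (upper i j i≤n j≤n j≤i)
  ; rowSum = λ i i≤n → trans (∑-cong (suc n) (λ j j≤n → sym (M≈M′ i j i≤n (≤-pred j≤n)))) (rowSum i i≤n)
  ; colSum = λ j j≤n → trans (∑-cong (suc n) (λ i i≤n → sym (M≈M′ i j (≤-pred i≤n) j≤n))) (colSum j j≤n)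
  }
  where open InFᴹ F

contract : Matrix → Matrix
contract M zero    zero    = 0
contract M zero    (suc j) = M 0 (2 + j) + M 1 (2 + j)
contract M (suc i) j       = M (2 + i) (suc j)

module _ {k : ℕ} {M : Matrix} (F : InFᴹ (2 + k) M) where
  open InFᴹ F

  M01≡2 : M 0 1 ≡ 2
  M01≡2 = begin
    M 0 1                       ≡⟨ sym (+-identityʳ _) ⟩
    M 0 1 + 0                   ≡⟨ cong (M 0 1 +_) (sym below) ⟩
    ∑ (3 + k) (λ i → M i 1)     ≡⟨ colSum 1 (s≤s z≤n) ⟩
    2                           ∎
    where
    open ≡-Reasoning
    below : ∑ (2 + k) (λ i → M (suc i) 1) ≡ 0
    below = ∑-zero (2 + k) (λ i i<2+k → upper (suc i) 1 i<2+k (s≤s z≤n) (s≤s z≤n))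

  row0-from2 : ∑ (1 + k) (λ j → M 0 (2 + j)) ≡ 1
  row0-from2 = +-cancelˡ-≡ 2 _ _
    (trans (cong₂ _+_ (sym (upper 0 0 z≤n z≤n z≤n)) (cong (_+ rest) (sym M01≡2))) (rowSum 0 z≤n))
    where
    rest : ℕ
    rest = ∑ (1 + k) (λ j → M 0 (2 + j))

  row1-from2 : ∑ (1 + k) (λ j → M 1 (2 + j)) ≡ 2
  row1-from2 = trans
    (cong₂ _+_ (sym (upper 1 0 (s≤s z≤n) z≤n z≤n)) (cong (_+ rest) (sym (upper 1 1 (s≤s z≤n) (s≤s z≤n) ≤-refl))))
    (rowSum 1 (s≤s z≤n))
    where
    rest : ℕ
    rest = ∑ (1 + k) (λ j → M 1 (2 + j))

module _ {k : ℕ} {M : Matrix} (F : InFᴹ (3 + k) M) where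
  open InFᴹ F

  M02+M12≡2 : M 0 2 + M 1 2 ≡ 2
  M02+M12≡2 = begin
    M 0 2 + M 1 2               ≡⟨ cong (M 0 2 +_) (sym (+-identityʳ _)) ⟩
    M 0 2 + (M 1 2 + 0)         ≡⟨ cong (λ x → M 0 2 + (M 1 2 + x)) (sym below) ⟩
    ∑ (4 + k) (λ i → M i 2)     ≡⟨ colSum 2 (s≤s (s≤s z≤n)) ⟩
    2                           ∎
    where
    open ≡-Reasoning
    below : ∑ (2 + k) (λ i → M (2 + i) 2) ≡ 0
    below = ∑-zero (2 + k) (λ i i<2+k → upper (2 + i) 2 (s≤s i<2+k) (s≤s (s≤s z≤n)) (s≤s (s≤s z≤n)))

  contract-InFᴹ : InFᴹ (2 + k) (contract M)
  contract-InFᴹ = record { upper = upper′ ; rowSum = rowSum′ ; colSum = colSum′ }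
    where
    upper′ : ∀ i j → i ≤ 2 + k → j ≤ 2 + k → j ≤ i → contract M i j ≡ 0
    upper′ zero    zero _ _ _ = refl
    upper′ (suc i) j (s≤s i≤) j≤ j≤i = upper (2 + i) (suc j) (s≤s (s≤s i≤)) (s≤s j≤) (s≤s j≤i)
    rowSum′ : ∀ i → i ≤ 2 + k → ∑ (3 + k) (contract M i) ≡ outSpecℕ (2 + k) i
    rowSum′ zero _ = trans (∑-distrib-+ (2 + k) (λ j → M 0 (2 + j)) (λ j → M 1 (2 + j)))
                           (cong₂ _+_ (row0-from2 F) (row1-from2 F))
    rowSum′ (suc i) (s≤s i≤) =
      trans (cong (_+ ∑ (3 + k) (contract M (suc i))) (sym (upper (2 + i) 0 (s≤s (s≤s i≤)) z≤n z≤n)))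
            (rowSum (2 + i) (s≤s (s≤s i≤)))
    colSum′ : ∀ j → j ≤ 2 + k → ∑ (3 + k) (λ i → contract M i j) ≡ inSpecℕ (2 + k) j
    colSum′ zero _ = ∑-zero (2 + k) (λ i i< → upper (2 + i) 1 (s≤s i<) (s≤s z≤n) (s≤s z≤n))
    colSum′ (suc j) (s≤s j≤) = trans (+-assoc (M 0 (2 + j)) (M 1 (2 + j)) _) (colSum (2 + j) (s≤s (s≤s j≤)))

  -- Column 2 receives its two edges either as (0,2),(1,2) or as a double (1,2);
  -- in the first case row 0 is exhausted at column 2, in the second row 1 is.
  vertex1-branch :
      (M 1 2 ≡ 1 × M 0 2 ≡ 1 × (∀ t → t ≤ k → M 0 (3 + t) ≡ 0))
    ⊎ (M 1 2 ≡ 2 × M 0 2 ≡ 0 × (∀ t → t ≤ k → M 1 (3 + t) ≡ 0))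
  vertex1-branch with M 0 2 | M 1 2 | M02+M12≡2 | row0-from2 F | row1-from2 F
  ... | zero        | _ | refl | _    | row1 =
    inj₂ (refl , refl , λ t t≤k → ∑≡0⇒ (suc k) (λ t → M 1 (3 + t)) (+-cancelˡ-≡ 2 _ 0 row1) t (s≤s t≤k))
  ... | suc zero    | _ | refl | row0 | _    =
    inj₁ (refl , refl , λ t t≤k → ∑≡0⇒ (suc k) (λ t → M 0 (3 + t)) (suc-injective row0) t (s≤s t≤k))
  ... | suc (suc _) | _ | _    | ()   | _

-- Inverse of contract, given the multiplicity u ∈ {1, 2} of the edge (1,2).
expand : ℕ → Matrix → Matrix
expand u N zero          zero                = 0
expand u N zero          (suc zero)          = 2
expand u N zero          (suc (suc zero))    = 2 ∸ u
expand u N zero          (suc (suc (suc t))) = if u ≡ᵇ 1 then 0 else N 0 (2 + t)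
expand u N (suc zero)    zero                = 0
expand u N (suc zero)    (suc zero)          = 0
expand u N (suc zero)    (suc (suc zero))    = u
expand u N (suc zero)    (suc (suc (suc t))) = if u ≡ᵇ 1 then N 0 (2 + t) else 0
expand u N (suc (suc i)) zero                = 0
expand u N (suc (suc i)) (suc j)             = N (suc i) j

expand-cong : ∀ {k} u {N N′} → N ≈[ 2 + k ] N′ → expand u N ≈[ 3 + k ] expand u N′
expand-cong u N≈N′ zero          (suc (suc (suc t))) _ (s≤s t≤) =
  cong (λ x → if u ≡ᵇ 1 then 0 else x) (N≈N′ 0 (2 + t) z≤n t≤)
expand-cong u N≈N′ (suc zero)    (suc (suc (suc t))) _ (s≤s t≤) =
  cong (λ x → if u ≡ᵇ 1 then x else 0) (N≈N′ 0 (2 + t) z≤n t≤)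
expand-cong u N≈N′ (suc (suc i)) (suc j) (s≤s i≤) (s≤s j≤) = N≈N′ (suc i) j i≤ j≤
expand-cong u N≈N′ zero          zero                _ _ = refl
expand-cong u N≈N′ zero          (suc zero)          _ _ = refl
expand-cong u N≈N′ zero          (suc (suc zero))    _ _ = refl
expand-cong u N≈N′ (suc zero)    zero                _ _ = refl
expand-cong u N≈N′ (suc zero)    (suc zero)          _ _ = refl
expand-cong u N≈N′ (suc zero)    (suc (suc zero))    _ _ = refl
expand-cong u N≈N′ (suc (suc i)) zero                _ _ = refl

expand-contract : ∀ {k M} → InFᴹ (3 + k) M → M ≈[ 3 + k ] expand (M 1 2) (contract M)
expand-contract F zero          zero             _ _ = InFᴹ.upper F 0 0 z≤n z≤n z≤n
expand-contract F zero          (suc zero)       _ _ = M01≡2 F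
expand-contract {M = M} F zero (suc (suc zero)) _ _ =
  trans (sym (m+n∸n≡m (M 0 2) (M 1 2))) (cong (_∸ M 1 2) (M02+M12≡2 F))
expand-contract F (suc zero)    zero             _ _ = InFᴹ.upper F 1 0 (s≤s z≤n) z≤n z≤n
expand-contract F (suc zero)    (suc zero)       _ _ = InFᴹ.upper F 1 1 (s≤s z≤n) (s≤s z≤n) ≤-refl
expand-contract F (suc zero)    (suc (suc zero)) _ _ = refl
expand-contract F (suc (suc i)) zero i≤ _ = InFᴹ.upper F (2 + i) 0 i≤ z≤n z≤n
expand-contract F (suc (suc i)) (suc j)          _ _ = refl
expand-contract {M = M} F zero (suc (suc (suc t))) _ (s≤s (s≤s (s≤s t≤))) with vertex1-branch F
... | inj₁ (M12≡1 , _ , row0≡0) rewrite M12≡1 = row0≡0 t t≤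
... | inj₂ (M12≡2 , _ , row1≡0) rewrite M12≡2 | row1≡0 t t≤ = sym (+-identityʳ _)
expand-contract {M = M} F (suc zero) (suc (suc (suc t))) _ (s≤s (s≤s (s≤s t≤))) with vertex1-branch F
... | inj₁ (M12≡1 , _ , row0≡0) rewrite M12≡1 | row0≡0 t t≤ = refl
... | inj₂ (M12≡2 , _ , row1≡0) rewrite M12≡2 = row1≡0 t t≤

F₂ : Matrix
F₂ 0 1 = 2
F₂ 0 2 = 1
F₂ 1 2 = 2
F₂ _ _ = 0

F₂-unique : ∀ {M} → InFᴹ 2 M → M ≈[ 2 ] F₂
F₂-unique F 0 0 _ _ = InFᴹ.upper F 0 0 z≤n z≤n z≤n
F₂-unique F 0 1 _ _ = M01≡2 F
F₂-unique F 0 2 _ _ = trans (sym (+-identityʳ _)) (row0-from2 F)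
F₂-unique F 1 0 _ _ = InFᴹ.upper F 1 0 (s≤s z≤n) z≤n z≤n
F₂-unique F 1 1 _ _ = InFᴹ.upper F 1 1 (s≤s z≤n) (s≤s z≤n) ≤-refl
F₂-unique F 1 2 _ _ = trans (sym (+-identityʳ _)) (row1-from2 F)
F₂-unique F 2 j i≤2 j≤2 = InFᴹ.upper F 2 j i≤2 j≤2 j≤2
F₂-unique F (suc (suc (suc _))) _ (s≤s (s≤s ())) _
F₂-unique F 0 (suc (suc (suc _))) _ (s≤s (s≤s ()))
F₂-unique F 1 (suc (suc (suc _))) _ (s≤s (s≤s ()))

superdiagonal-determines : ∀ k {M M′} → InFᴹ (2 + k) M → InFᴹ (2 + k) M′ →
                           SameSuperdiagonal (2 + k) M M′ → M ≈[ 2 + k ] M′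
superdiagonal-determines zero    F F′ _ i j i≤ j≤ = trans (F₂-unique F i j i≤ j≤) (sym (F₂-unique F′ i j i≤ j≤))
superdiagonal-determines (suc k) {M} {M′} F F′ same i j i≤ j≤ = begin
  M i j                                   ≡⟨ expand-contract F i j i≤ j≤ ⟩
  expand (M 1 2) (contract M) i j         ≡⟨ cong (λ u → expand u (contract M) i j) (same 1 (s≤s (s≤s z≤n))) ⟩
  expand (M′ 1 2) (contract M) i j        ≡⟨ expand-cong (M′ 1 2) contracted i j i≤ j≤ ⟩
  expand (M′ 1 2) (contract M′) i j       ≡⟨ sym (expand-contract F′ i j i≤ j≤) ⟩
  M′ i j                                  ∎
  where
  open ≡-Reasoning
  same′ : SameSuperdiagonal (2 + k) (contract M) (contract M′)
  same′ zero    _         = trans (M02+M12≡2 F) (sym (M02+M12≡2 F′))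
  same′ (suc i) (s≤s i<) = same (2 + i) (s≤s (s≤s i<))
  contracted : contract M ≈[ 2 + k ] contract M′
  contracted = superdiagonal-determines k (contract-InFᴹ F) (contract-InFᴹ F′) same′

last-superdiagonal : ∀ k {M} → InFᴹ (2 + k) M → M (suc k) (2 + k) ≡ 2
last-superdiagonal zero    F = F₂-unique F 1 2 (s≤s z≤n) ≤-refl
last-superdiagonal (suc k) F = last-superdiagonal k (contract-InFᴹ F)

inner-superdiagonal : ∀ k {M} → InFᴹ (2 + k) M → ∀ i → 1 ≤ i → i ≤ k →
                      M i (suc i) ≡ 1 ⊎ M i (suc i) ≡ 2
inner-superdiagonal (suc k) F (suc zero) _ _ with vertex1-branch F
... | inj₁ (M12≡1 , _) = inj₁ M12≡1
... | inj₂ (M12≡2 , _) = inj₂ M12≡2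
inner-superdiagonal (suc k) F (suc (suc i)) _ (s≤s i≤k) =
  inner-superdiagonal k (contract-InFᴹ F) (suc i) (s≤s z≤n) i≤k

spanning-edge : ∀ k {M} → InFᴹ (2 + k) M → ∀ l → 1 ≤ l → l ≤ k → M l (suc l) ≡ 2 →
                ∃[ a ] ∃[ d ] (a < l × suc l < d × d ≤ 2 + k × 1 ≤ M a d)
spanning-edge (suc k) {M} F (suc zero) _ _ M12≡2 with vertex1-branch F
... | inj₁ (M12≡1 , _) = ⊥-elim (1≢2 (trans (sym M12≡1) M12≡2))
  where 1≢2 : ¬ 1 ≡ 2
        1≢2 ()
... | inj₂ (_ , M02≡0 , _) with 1≤∑⇒ (suc k) (λ t → M 0 (3 + t)) 1≤∑
  where 1≤∑ : 1 ≤ ∑ (suc k) (λ t → M 0 (3 + t))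
        1≤∑ = ≤-reflexive (sym (trans (cong (_+ ∑ (suc k) (λ t → M 0 (3 + t))) (sym M02≡0)) (row0-from2 F)))
...   | t , t≤k , 1≤M0t = 0 , 3 + t , s≤s z≤n , s≤s (s≤s (s≤s z≤n)) , s≤s (s≤s t≤k) , 1≤M0t
spanning-edge (suc k) {M} F (suc (suc l)) _ (s≤s l≤k) M≡2
  with spanning-edge k (contract-InFᴹ F) (suc l) (s≤s z≤n) l≤k M≡2
... | suc a , d             , s≤s a<l , l<d , d≤ , 1≤M = 2 + a , suc d , s≤s (s≤s a<l) , s≤s l<d , s≤s d≤ , 1≤M
... | zero  , suc zero      , _       , s≤s () , _ , _
-- An edge out of the merged vertex comes from vertex 0 or vertex 1.
... | zero  , suc (suc d)   , _       , l<d , d≤ , 1≤M with M 0 (3 + d) in M0d≡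
...   | suc _ = 0 , 3 + d , s≤s z≤n , s≤s l<d , s≤s d≤ , subst (1 ≤_) (sym M0d≡) (s≤s z≤n)
...   | zero  = 1 , 3 + d , s≤s (s≤s z≤n) , s≤s l<d , s≤s d≤ , 1≤M

-- Interchanges

δ : ℕ → ℕ → ℕ → ℕ → ℕ
δ i j x y = ⟦ (i ≡ᵇ x) ∧ (j ≡ᵇ y) ⟧

δ-≢ˡ : ∀ {i x} j y → ¬ i ≡ x → δ i j x y ≡ 0
δ-≢ˡ j y i≢x rewrite ≢⇒≡ᵇ≡false i≢x = refl

δ-≢ʳ : ∀ i j x y → ¬ j ≡ y → δ i j x y ≡ 0
δ-≢ʳ i j x y j≢y rewrite ≢⇒≡ᵇ≡false j≢y | ∧-zeroʳ (i ≡ᵇ x) = refl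

δ-diag : ∀ x y → δ x y x y ≡ 1
δ-diag x y rewrite ≡ᵇ-refl x | ≡ᵇ-refl y = refl

δ-lower : ∀ {i j x y} → x < y → j ≤ i → δ i j x y ≡ 0
δ-lower {i} {j} {x} {y} x<y j≤i with i ≟ x
... | no  i≢x  = δ-≢ˡ j y i≢x
... | yes refl = δ-≢ʳ i j i y (λ { refl → <⇒≱ x<y j≤i })

δ-superdiagonal : ∀ i {x y} → suc x < y → δ i (suc i) x y ≡ 0
δ-superdiagonal i {x} {y} 1+x<y with i ≟ x
... | no  i≢x  = δ-≢ˡ (suc i) y i≢x
... | yes refl = δ-≢ʳ i (suc i) i y (λ { refl → <-irrefl refl 1+x<y })

δ-≤ : ∀ (M : Matrix) {x y} i j → 1 ≤ M x y → δ i j x y ≤ M i j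
δ-≤ M {x} {y} i j 1≤Mxy with i ≟ x | j ≟ y
... | yes refl | yes refl = subst (_≤ M i j) (sym (δ-diag i j)) 1≤Mxy
... | no  i≢x  | _        = subst (_≤ M i j) (sym (δ-≢ˡ j y i≢x)) z≤n
... | yes _    | no  j≢y  = subst (_≤ M i j) (sym (δ-≢ʳ i j x y j≢y)) z≤n

∑-δ-row : ∀ N i x {y} → y < N → ∑ N (λ j → δ i j x y) ≡ ⟦ i ≡ᵇ x ⟧
∑-δ-row N i x {y} y<N with i ≡ᵇ x
... | true  = ∑-≡ᵇ N y y<N
... | false = ∑-zero N (λ _ _ → refl)

∑-δ-col : ∀ N j {x} y → x < N → ∑ N (λ i → δ i j x y) ≡ ⟦ j ≡ᵇ y ⟧
∑-δ-col N j {x} y x<N with j ≡ᵇ y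
... | true  = trans (∑-cong N (λ i _ → cong ⟦_⟧ (∧-identityʳ (i ≡ᵇ x)))) (∑-≡ᵇ N x x<N)
... | false = ∑-zero N (λ i _ → cong ⟦_⟧ (∧-zeroʳ (i ≡ᵇ x)))

∑-balance : ∀ m (f′ p q f r t : ℕ → ℕ) → (∀ j → j < m → f′ j + p j + q j ≡ f j + r j + t j) →
            ∑ m f′ + ∑ m p + ∑ m q ≡ ∑ m f + ∑ m r + ∑ m t
∑-balance m f′ p q f r t eq = begin
  ∑ m f′ + ∑ m p + ∑ m q                  ≡⟨ sym (sum₃ f′ p q) ⟩
  ∑ m (λ j → f′ j + p j + q j)            ≡⟨ ∑-cong m eq ⟩
  ∑ m (λ j → f j + r j + t j)             ≡⟨ sum₃ f r t ⟩
  ∑ m f + ∑ m r + ∑ m t                   ∎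
  where
  open ≡-Reasoning
  sum₃ : ∀ f g h → ∑ m (λ j → f j + g j + h j) ≡ ∑ m f + ∑ m g + ∑ m h
  sum₃ f g h = trans (∑-distrib-+ m (λ j → f j + g j) h) (cong (_+ ∑ m h) (∑-distrib-+ m f g))

+-cancelʳ₂ : ∀ x y p q → x + p + q ≡ y + p + q → x ≡ y
+-cancelʳ₂ x y p q eq = +-cancelʳ-≡ p x y (+-cancelʳ-≡ q (x + p) (y + p) eq)

record Interchangeᴹ (n : ℕ) (M M′ : Matrix) (a b c d : ℕ) : Set where
  field
    a<b     : a < b
    b<c     : b < c
    c<d     : c < d
    d≤n     : d ≤ n
    1≤Mad   : 1 ≤ M a d
    1≤Mbc   : 1 ≤ M b c
    balance : ∀ i j → i ≤ n → j ≤ n → M′ i j + δ i j a d + δ i j b c ≡ M i j + δ i j a c + δ i j b d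

module _ {n M M′ a b c d} (I : Interchangeᴹ n M M′ a b c d) where
  open Interchangeᴹ I

  c≤n : c ≤ n
  c≤n = ≤-trans (<⇒≤ c<d) d≤n
  b≤n : b ≤ n
  b≤n = ≤-trans (<⇒≤ b<c) c≤n
  a≤n : a ≤ n
  a≤n = ≤-trans (<⇒≤ a<b) b≤n

  Interchangeᴹ-resp : ∀ {N N′} → M ≈[ n ] N → M′ ≈[ n ] N′ → Interchangeᴹ n N N′ a b c d
  Interchangeᴹ-resp M≈N M′≈N′ = record
    { a<b = a<b ; b<c = b<c ; c<d = c<d ; d≤n = d≤n
    ; 1≤Mad = subst (1 ≤_) (M≈N a d a≤n d≤n) 1≤Mad
    ; 1≤Mbc = subst (1 ≤_) (M≈N b c b≤n c≤n) 1≤Mbc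
    ; balance = λ i j i≤n j≤n →
        subst₂ (λ x y → x + δ i j a d + δ i j b c ≡ y + δ i j a c + δ i j b d)
               (M′≈N′ i j i≤n j≤n) (M≈N i j i≤n j≤n) (balance i j i≤n j≤n)
    }

  interchange-InFᴹ : InFᴹ n M → InFᴹ n M′
  interchange-InFᴹ F = record { upper = upper′ ; rowSum = rowSum′ ; colSum = colSum′ }
    where
    open InFᴹ F
    open ≡-Reasoning
    a<c : a < c
    a<c = <-trans a<b b<c
    b<d : b < d
    b<d = <-trans b<c c<d
    a<d : a < d
    a<d = <-trans a<b b<d
    upper′ : ∀ i j → i ≤ n → j ≤ n → j ≤ i → M′ i j ≡ 0
    upper′ i j i≤n j≤n j≤i = begin
      M′ i j                            ≡⟨ sym (trans (+-identityʳ _) (+-identityʳ _)) ⟩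
      M′ i j + 0 + 0                    ≡⟨ cong₂ (λ x y → M′ i j + x + y) (sym (δ-lower a<d j≤i)) (sym (δ-lower b<c j≤i)) ⟩
      M′ i j + δ i j a d + δ i j b c    ≡⟨ balance i j i≤n j≤n ⟩
      M i j + δ i j a c + δ i j b d     ≡⟨ cong₂ _+_ (cong₂ _+_ (upper i j i≤n j≤n j≤i) (δ-lower a<c j≤i)) (δ-lower b<d j≤i) ⟩
      0                                 ∎
    rowSum′ : ∀ i → i ≤ n → ∑ (suc n) (M′ i) ≡ outSpecℕ n i
    rowSum′ i i≤n = +-cancelʳ₂ _ _ ⟦ i ≡ᵇ a ⟧ ⟦ i ≡ᵇ b ⟧ (begin
      ∑ (suc n) (M′ i) + ⟦ i ≡ᵇ a ⟧ + ⟦ i ≡ᵇ b ⟧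
        ≡⟨ sym (cong₂ (λ x y → ∑ (suc n) (M′ i) + x + y) (∑-δ-row (suc n) i a (s≤s d≤n)) (∑-δ-row (suc n) i b (s≤s c≤n))) ⟩
      ∑ (suc n) (M′ i) + ∑ (suc n) (λ j → δ i j a d) + ∑ (suc n) (λ j → δ i j b c)
        ≡⟨ ∑-balance (suc n) (M′ i) (λ j → δ i j a d) (λ j → δ i j b c) (M i) (λ j → δ i j a c) (λ j → δ i j b d)
                     (λ j j≤n → balance i j i≤n (≤-pred j≤n)) ⟩
      ∑ (suc n) (M i) + ∑ (suc n) (λ j → δ i j a c) + ∑ (suc n) (λ j → δ i j b d)
        ≡⟨ cong₂ _+_ (cong₂ _+_ (rowSum i i≤n) (∑-δ-row (suc n) i a (s≤s c≤n))) (∑-δ-row (suc n) i b (s≤s d≤n)) ⟩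
      outSpecℕ n i + ⟦ i ≡ᵇ a ⟧ + ⟦ i ≡ᵇ b ⟧ ∎)
    colSum′ : ∀ j → j ≤ n → ∑ (suc n) (λ i → M′ i j) ≡ inSpecℕ n j
    colSum′ j j≤n = +-cancelʳ₂ _ _ ⟦ j ≡ᵇ d ⟧ ⟦ j ≡ᵇ c ⟧ (begin
      ∑ (suc n) (λ i → M′ i j) + ⟦ j ≡ᵇ d ⟧ + ⟦ j ≡ᵇ c ⟧
        ≡⟨ sym (cong₂ (λ x y → ∑ (suc n) (λ i → M′ i j) + x + y) (∑-δ-col (suc n) j d (s≤s a≤n)) (∑-δ-col (suc n) j c (s≤s b≤n))) ⟩
      ∑ (suc n) (λ i → M′ i j) + ∑ (suc n) (λ i → δ i j a d) + ∑ (suc n) (λ i → δ i j b c)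
        ≡⟨ ∑-balance (suc n) (λ i → M′ i j) (λ i → δ i j a d) (λ i → δ i j b c) (λ i → M i j) (λ i → δ i j a c) (λ i → δ i j b d)
                     (λ i i≤n → balance i j (≤-pred i≤n) j≤n) ⟩
      ∑ (suc n) (λ i → M i j) + ∑ (suc n) (λ i → δ i j a c) + ∑ (suc n) (λ i → δ i j b d)
        ≡⟨ cong₂ _+_ (cong₂ _+_ (colSum j j≤n) (∑-δ-col (suc n) j c (s≤s a≤n))) (∑-δ-col (suc n) j d (s≤s b≤n)) ⟩
      inSpecℕ n j + ⟦ j ≡ᵇ c ⟧ + ⟦ j ≡ᵇ d ⟧
        ≡⟨ xy∙z≈xz∙y (inSpecℕ n j) _ _ ⟩
      inSpecℕ n j + ⟦ j ≡ᵇ d ⟧ + ⟦ j ≡ᵇ c ⟧ ∎)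

  -- Of the four edges involved only (b,c) can lie on the superdiagonal.
  interchange-superdiagonal : ∀ i → i < n → M′ i (suc i) + δ i (suc i) b c ≡ M i (suc i)
  interchange-superdiagonal i i<n = begin
    M′ i (suc i) + δ i (suc i) b c
      ≡⟨ cong (_+ δ i (suc i) b c) (sym (trans (cong (M′ i (suc i) +_) (δ-superdiagonal i 1+a<d)) (+-identityʳ _))) ⟩
    M′ i (suc i) + δ i (suc i) a d + δ i (suc i) b c
      ≡⟨ balance i (suc i) (<⇒≤ i<n) i<n ⟩
    M i (suc i) + δ i (suc i) a c + δ i (suc i) b d
      ≡⟨ cong₂ (λ x y → M i (suc i) + x + y) (δ-superdiagonal i (≤-trans (s≤s a<b) b<c)) (δ-superdiagonal i (≤-trans (s≤s b<c) c<d)) ⟩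
    M i (suc i) + 0 + 0
      ≡⟨ trans (+-identityʳ _) (+-identityʳ _) ⟩
    M i (suc i) ∎
    where
    open ≡-Reasoning
    1+a<d : suc a < d
    1+a<d = ≤-trans (s≤s a<b) (<-trans b<c c<d)

  interchange-superdiagonal-≢ : ∀ i → i < n → ¬ i ≡ b → M′ i (suc i) ≡ M i (suc i)
  interchange-superdiagonal-≢ i i<n i≢b =
    trans (sym (trans (cong (M′ i (suc i) +_) (δ-≢ˡ (suc i) c i≢b)) (+-identityʳ _))) (interchange-superdiagonal i i<n)

  interchange-superdiagonal-≤ : ∀ i → i < n → M′ i (suc i) ≤ M i (suc i)
  interchange-superdiagonal-≤ i i<n =
    ≤-trans (m≤m+n (M′ i (suc i)) (δ i (suc i) b c)) (≤-reflexive (interchange-superdiagonal i i<n))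

interchange-superdiagonal-at : ∀ {n M M′ a l d} → Interchangeᴹ n M M′ a l (suc l) d →
                               l < n → M′ l (suc l) + 1 ≡ M l (suc l)
interchange-superdiagonal-at {M′ = M′} {l = l} I l<n =
  trans (cong (M′ l (suc l) +_) (sym (δ-diag l (suc l)))) (interchange-superdiagonal I l l<n)

-- The truncated subtraction is exact only when M contains both (a,d) and (b,c).
interchanged : Matrix → ℕ → ℕ → ℕ → ℕ → Matrix
interchanged M a b c d i j = M i j + δ i j a c + δ i j b d ∸ (δ i j a d + δ i j b c)

interchanged-Interchangeᴹ : ∀ {n M a b c d} → a < b → b < c → c < d → d ≤ n → 1 ≤ M a d → 1 ≤ M b c →
                           Interchangeᴹ n M (interchanged M a b c d) a b c d
interchanged-Interchangeᴹ {n} {M} {a} {b} {c} {d} a<b b<c c<d d≤n 1≤Mad 1≤Mbc = record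
  { a<b = a<b ; b<c = b<c ; c<d = c<d ; d≤n = d≤n ; 1≤Mad = 1≤Mad ; 1≤Mbc = 1≤Mbc
  ; balance = λ i j _ _ → trans (+-assoc (interchanged M a b c d i j) (δ i j a d) (δ i j b c))
                                (m∸n+n≡m (≤-trans (removed≤M i j) (≤-trans (m≤m+n _ _) (m≤m+n _ _))))
  }
  where
  removed≤M : ∀ i j → δ i j a d + δ i j b c ≤ M i j
  removed≤M i j with i ≟ a
  ... | yes refl = subst (λ x → δ i j a d + x ≤ M i j) (sym (δ-≢ˡ j c (<⇒≢ a<b)))
                         (subst (_≤ M i j) (sym (+-identityʳ _)) (δ-≤ M i j 1≤Mad))
  ... | no  i≢a  = subst (λ x → x + δ i j b c ≤ M i j) (sym (δ-≢ˡ j d i≢a)) (δ-≤ M i j 1≤Mbc)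

-- Bit vectors and superdiagonals

weight : Bool → ℕ
weight b = if b then 1 else 2

-- Entry i is the multiplicity of (i, i+1) in G_b (0-based vertices): 2 at both ends, and in
-- between the weight of the i-th bit of b, counting from 1.
superdiagonal : ∀ {k} → Vec Bool k → ℕ → ℕ
superdiagonal b       zero          = 2
superdiagonal []      (suc i)       = 2
superdiagonal (x ∷ b) (suc zero)    = weight x
superdiagonal (x ∷ b) (suc (suc i)) = superdiagonal b (suc i)

superdiagonal-last : ∀ {k} (b : Vec Bool k) → superdiagonal b (suc k) ≡ 2
superdiagonal-last []      = refl
superdiagonal-last (x ∷ b) = superdiagonal-last b

superdiagonal-injective : ∀ {k} (b b′ : Vec Bool k) →
  (∀ i → 1 ≤ i → i ≤ k → superdiagonal b i ≡ superdiagonal b′ i) → b ≡ b′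
superdiagonal-injective []      []        _    = refl
superdiagonal-injective (x ∷ b) (x′ ∷ b′) same =
  cong₂ _∷_ (weight-injective x x′ (same 1 ≤-refl (s≤s z≤n)))
            (superdiagonal-injective b b′ (λ { (suc i) _ (s≤s i≤k) → same (2 + i) (s≤s z≤n) (s≤s (s≤s i≤k)) }))
  where
  weight-injective : ∀ x x′ → weight x ≡ weight x′ → x ≡ x′
  weight-injective false false _ = refl
  weight-injective true  true  _ = refl

superdiagonal-antitone : ∀ {k} (b b′ : Vec Bool k) →
  (∀ i → 1 ≤ i → i ≤ k → superdiagonal b′ i ≤ superdiagonal b i) → Pointwise B._≤_ b b′
superdiagonal-antitone []      []        _  = []
superdiagonal-antitone (x ∷ b) (x′ ∷ b′) ≥ =
  weight-antitone x x′ (≥ 1 ≤-refl (s≤s z≤n))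
  ∷ superdiagonal-antitone b b′ (λ { (suc i) _ (s≤s i≤k) → ≥ (2 + i) (s≤s z≤n) (s≤s (s≤s i≤k)) })
  where
  weight-antitone : ∀ x x′ → weight x′ ≤ weight x → x B.≤ x′
  weight-antitone false false _ = B.b≤b
  weight-antitone false true  _ = B.f≤t
  weight-antitone true  true  _ = B.b≤b
  weight-antitone true  false (s≤s ())

bitsOf : (k : ℕ) → (ℕ → ℕ) → Vec Bool k
bitsOf zero    s = []
bitsOf (suc k) s = (s 1 ≡ᵇ 1) ∷ bitsOf k (s ∘ suc)

superdiagonal-bitsOf : ∀ k s → (∀ i → 1 ≤ i → i ≤ k → s i ≡ 1 ⊎ s i ≡ 2) →
                       ∀ i → 1 ≤ i → i ≤ k → superdiagonal (bitsOf k s) i ≡ s i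
superdiagonal-bitsOf (suc k) s s∈ (suc zero) _ _ with s 1 | s∈ 1 ≤-refl (s≤s z≤n)
... | _ | inj₁ refl = refl
... | _ | inj₂ refl = refl
superdiagonal-bitsOf (suc k) s s∈ (suc (suc i)) _ (s≤s i≤k) =
  superdiagonal-bitsOf k (s ∘ suc) (λ { (suc j) _ (s≤s j≤k) → s∈ (2 + j) (s≤s z≤n) (s≤s (s≤s j≤k)) })
                       (suc i) (s≤s z≤n) i≤k

data Raise : ∀ {k} → Vec Bool k → Vec Bool k → Set where
  here  : ∀ {k} {v : Vec Bool k} → Raise (false ∷ v) (true ∷ v)
  there : ∀ {k x} {v w : Vec Bool k} → Raise v w → Raise (x ∷ v) (x ∷ w)

Pointwise-≤⇒Raise* : ∀ {k} {b b′ : Vec Bool k} → Pointwise B._≤_ b b′ → Star Raise b b′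
Pointwise-≤⇒Raise* []                        = ε
Pointwise-≤⇒Raise* {b = x ∷ _} (x≤x′ ∷ b≤b′) = gmap (x ∷_) there (Pointwise-≤⇒Raise* b≤b′) ◅◅ raiseHead x≤x′
  where
  raiseHead : ∀ {x x′ k} {v : Vec Bool k} → x B.≤ x′ → Star Raise (x ∷ v) (x′ ∷ v)
  raiseHead B.b≤b = ε
  raiseHead B.f≤t = here ◅ ε

Raise-superdiagonal : ∀ {k} {b b′ : Vec Bool k} → Raise b b′ →
  ∃[ l ] (1 ≤ l × l ≤ k × superdiagonal b l ≡ 2 × superdiagonal b′ l ≡ 1
          × (∀ i → ¬ i ≡ l → superdiagonal b i ≡ superdiagonal b′ i))
Raise-superdiagonal (here {v = v}) = 1 , ≤-refl , s≤s z≤n , refl , refl , elsewhere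
  where
  elsewhere : ∀ i → ¬ i ≡ 1 → superdiagonal (false ∷ v) i ≡ superdiagonal (true ∷ v) i
  elsewhere zero          _   = refl
  elsewhere (suc zero)    i≢1 = ⊥-elim (i≢1 refl)
  elsewhere (suc (suc i)) _   = refl
Raise-superdiagonal (there {x = x} {v} {w} r) with Raise-superdiagonal r
... | suc l , _ , l≤k , v≡2 , w≡1 , same = 2 + l , s≤s z≤n , s≤s l≤k , v≡2 , w≡1 , elsewhere
  where
  elsewhere : ∀ i → ¬ i ≡ 2 + l → superdiagonal (x ∷ v) i ≡ superdiagonal (x ∷ w) i
  elsewhere zero          _ = refl
  elsewhere (suc zero)    _ = refl
  elsewhere (suc (suc i)) i≢ = same (suc i) (λ i≡ → i≢ (cong suc i≡))

-- Graphs as matrices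

-- 0 outside the index range.
index : ∀ {k} → Vec ℕ k → ℕ → ℕ
index []       _       = 0
index (x ∷ xs) zero    = x
index (x ∷ xs) (suc j) = index xs j

entries : ∀ {m k} → Vec (Vec ℕ k) m → Matrix
entries []       _       _ = 0
entries (r ∷ rs) zero    j = index r j
entries (r ∷ rs) (suc i) j = entries rs i j

index-lookup : ∀ {k} (v : Vec ℕ k) (j : Fin k) → lookup v j ≡ index v (toℕ j)
index-lookup (x ∷ v) Fin.zero    = refl
index-lookup (x ∷ v) (Fin.suc j) = index-lookup v j

entries-lookup : ∀ {m k} (G : Vec (Vec ℕ k) m) (i : Fin m) j → entries G (toℕ i) j ≡ index (lookup G i) j
entries-lookup (r ∷ G) Fin.zero    j = refl
entries-lookup (r ∷ G) (Fin.suc i) j = entries-lookup G i j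

mult≡entries : ∀ {n} (G : Graph n) i j → mult G i j ≡ entries G (toℕ i) (toℕ j)
mult≡entries G i j = trans (index-lookup (lookup G i) j) (sym (entries-lookup G i (toℕ j)))

sumV≡∑ : ∀ {k} (v : Vec ℕ k) → sumV v ≡ ∑ k (index v)
sumV≡∑ []      = refl
sumV≡∑ (x ∷ v) = cong (x +_) (sumV≡∑ v)

outdeg≡∑ : ∀ {n} (G : Graph n) i → outdeg G i ≡ ∑ (suc n) (entries G (toℕ i))
outdeg≡∑ {n} G i = trans (sumV≡∑ (lookup G i)) (∑-cong (suc n) (λ j _ → sym (entries-lookup G i j)))

indeg≡∑ : ∀ {m k} (G : Vec (Vec ℕ k) m) (j : Fin k) →
          sumV (Vec.map (λ row → lookup row j) G) ≡ ∑ m (λ i → entries G i (toℕ j))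
indeg≡∑ []      j = refl
indeg≡∑ (r ∷ G) j = cong₂ _+_ (index-lookup r j) (indeg≡∑ G j)

fin : ∀ {n} i → i ≤ n → Fin (suc n)
fin i i≤n = fromℕ< (s≤s i≤n)

toℕ-fin : ∀ {n} i (i≤n : i ≤ n) → toℕ (fin {n} i i≤n) ≡ i
toℕ-fin i i≤n = toℕ-fromℕ< (s≤s i≤n)

∀Fin⇒∀≤ : ∀ {n} (P : ℕ → Set) → (∀ (i : Fin (suc n)) → P (toℕ i)) → ∀ i → i ≤ n → P i
∀Fin⇒∀≤ P h i i≤n = subst P (toℕ-fin i i≤n) (h (fin i i≤n))

∀Fin²⇒∀≤² : ∀ {n} (P : ℕ → ℕ → Set) → (∀ (i j : Fin (suc n)) → P (toℕ i) (toℕ j)) →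
            ∀ i j → i ≤ n → j ≤ n → P i j
∀Fin²⇒∀≤² P h i j i≤n j≤n = subst₂ P (toℕ-fin i i≤n) (toℕ-fin j j≤n) (h (fin i i≤n) (fin j j≤n))

InF⇒InFᴹ : ∀ {n} (G : Graph n) → InF n G → InFᴹ n (entries G)
InF⇒InFᴹ {n} G (lower≡0 , out , in′) = record
  { upper  = ∀Fin²⇒∀≤² (λ i j → j ≤ i → entries G i j ≡ 0)
                       (λ i j j≤i → trans (sym (mult≡entries G i j)) (lower≡0 i j j≤i))
  ; rowSum = ∀Fin⇒∀≤ (λ i → ∑ (suc n) (entries G i) ≡ outSpecℕ n i) (λ i → trans (sym (outdeg≡∑ G i)) (out i))
  ; colSum = ∀Fin⇒∀≤ (λ j → ∑ (suc n) (λ i → entries G i j) ≡ inSpecℕ n j) (λ j → trans (sym (indeg≡∑ G j)) (in′ j))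
  }

InFᴹ⇒InF : ∀ {n} (G : Graph n) → InFᴹ n (entries G) → InF n G
InFᴹ⇒InF G F =
  (λ i j j≤i → trans (mult≡entries G i j) (upper (toℕ i) (toℕ j) (toℕ≤pred[n] i) (toℕ≤pred[n] j) j≤i)) ,
  (λ i → trans (outdeg≡∑ G i) (rowSum (toℕ i) (toℕ≤pred[n] i))) ,
  (λ j → trans (indeg≡∑ G j) (colSum (toℕ j) (toℕ≤pred[n] j)))
  where open InFᴹ F

entries-ext : ∀ {m k} (G H : Vec (Vec ℕ k) m) → (∀ i j → i < m → j < k → entries G i j ≡ entries H i j) → G ≡ H
entries-ext []      []      _   = refl
entries-ext (r ∷ G) (s ∷ H) G≈H =
  cong₂ _∷_ (index-ext r s (λ j j<k → G≈H 0 j (s≤s z≤n) j<k)) (entries-ext G H (λ i j i<m → G≈H (suc i) j (s≤s i<m)))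
  where
  index-ext : ∀ {k} (v w : Vec ℕ k) → (∀ j → j < k → index v j ≡ index w j) → v ≡ w
  index-ext []      []      _   = refl
  index-ext (x ∷ v) (y ∷ w) v≈w = cong₂ _∷_ (v≈w 0 (s≤s z≤n)) (index-ext v w (λ j j<k → v≈w (suc j) (s≤s j<k)))

≈⇒≡ : ∀ {n} (G H : Graph n) → entries G ≈[ n ] entries H → G ≡ H
≈⇒≡ G H G≈H = entries-ext G H (λ i j i<n j<n → G≈H i j (≤-pred i<n) (≤-pred j<n))

index-tabulate : ∀ {k} (g : Fin k → ℕ) j (j<k : j < k) → index (tabulate g) j ≡ g (fromℕ< j<k)
index-tabulate {suc k} g zero    _         = refl
index-tabulate {suc k} g (suc j) (s≤s j<k) = index-tabulate (g ∘ Fin.suc) j j<k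

entries-tabulate : ∀ {m k} (f : Fin m → Vec ℕ k) i (i<m : i < m) j → entries (tabulate f) i j ≡ index (f (fromℕ< i<m)) j
entries-tabulate {suc m} f zero    _         j = refl
entries-tabulate {suc m} f (suc i) (s≤s i<m) j = entries-tabulate (f ∘ Fin.suc) i i<m j

entries-tabulate² : ∀ {n} (h : Matrix) → entries {suc n} {suc n} (tabulate λ x → tabulate λ y → h (toℕ x) (toℕ y)) ≈[ n ] h
entries-tabulate² {n} h i j i≤n j≤n = begin
  entries {suc n} {suc n} (tabulate λ x → tabulate λ y → h (toℕ x) (toℕ y)) i j
    ≡⟨ entries-tabulate (λ x → tabulate λ y → h (toℕ x) (toℕ y)) i (s≤s i≤n) j ⟩
  index {suc n} (tabulate λ y → h (toℕ (fin {n} i i≤n)) (toℕ y)) j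
    ≡⟨ index-tabulate (λ y → h (toℕ (fin {n} i i≤n)) (toℕ y)) j (s≤s j≤n) ⟩
  h (toℕ (fin {n} i i≤n)) (toℕ (fin {n} j j≤n))
    ≡⟨ cong₂ h (toℕ-fin i i≤n) (toℕ-fin j j≤n) ⟩
  h i j ∎
  where open ≡-Reasoning

Interchange⇒Interchangeᴹ : ∀ {n} {G G′ : Graph n} → Interchange G G′ →
  ∃[ a ] ∃[ b ] ∃[ c ] ∃[ d ] Interchangeᴹ n (entries G) (entries G′) a b c d
Interchange⇒Interchangeᴹ {n} {G} {G′} (a , b , c , d , a<b , b<c , c<d , 1≤Gad , 1≤Gbc , eq) =
  toℕ a , toℕ b , toℕ c , toℕ d , record
    { a<b = a<b ; b<c = b<c ; c<d = c<d ; d≤n = toℕ≤pred[n] d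
    ; 1≤Mad = subst (1 ≤_) (mult≡entries G a d) 1≤Gad
    ; 1≤Mbc = subst (1 ≤_) (mult≡entries G b c) 1≤Gbc
    ; balance = ∀Fin²⇒∀≤² (λ i j → entries G′ i j + δ i j (toℕ a) (toℕ d) + δ i j (toℕ b) (toℕ c)
                                  ≡ entries G i j + δ i j (toℕ a) (toℕ c) + δ i j (toℕ b) (toℕ d))
                 (λ i j → subst₂ (λ x y → x + isPair i j a d + isPair i j b c ≡ y + isPair i j a c + isPair i j b d)
                                 (mult≡entries G′ i j) (mult≡entries G i j) (eq i j))
    }

Interchangeᴹ⇒Interchange : ∀ {n} {G G′ : Graph n} {a b c d} →
  Interchangeᴹ n (entries G) (entries G′) a b c d → Interchange G G′
Interchangeᴹ⇒Interchange {n} {G} {G′} {a} {b} {c} {d} I =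
  fin a (a≤n I) , fin b (b≤n I) , fin c (c≤n I) , fin d (Interchangeᴹ.d≤n I) ,
  subst₂ _<_ (sym ta) (sym tb) a<b , subst₂ _<_ (sym tb) (sym tc) b<c , subst₂ _<_ (sym tc) (sym td) c<d ,
  subst (1 ≤_) (sym (trans (mult≡entries G _ _) (cong₂ (entries G) ta td))) 1≤Mad ,
  subst (1 ≤_) (sym (trans (mult≡entries G _ _) (cong₂ (entries G) tb tc))) 1≤Mbc ,
  balance′
  where
  open Interchangeᴹ I
  ta : toℕ (fin {n} a (a≤n I)) ≡ a
  ta = toℕ-fin a (a≤n I)
  tb : toℕ (fin {n} b (b≤n I)) ≡ b
  tb = toℕ-fin b (b≤n I)
  tc : toℕ (fin {n} c (c≤n I)) ≡ c
  tc = toℕ-fin c (c≤n I)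
  td : toℕ (fin {n} d d≤n) ≡ d
  td = toℕ-fin d d≤n
  balance′ : ∀ i j → mult G′ i j + isPair i j (fin a (a≤n I)) (fin d d≤n) + isPair i j (fin b (b≤n I)) (fin c (c≤n I))
                   ≡ mult G i j + isPair i j (fin a (a≤n I)) (fin c (c≤n I)) + isPair i j (fin b (b≤n I)) (fin d d≤n)
  balance′ i j rewrite ta | tb | tc | td | mult≡entries G′ i j | mult≡entries G i j =
    balance (toℕ i) (toℕ j) (toℕ≤pred[n] i) (toℕ≤pred[n] j)

⪯-InF : ∀ {n} {G H : Graph n} → G ⪯ H → InF n G → InF n H
⪯-InF ε              F = F
⪯-InF {G = G} (_◅_ {j = K} step steps) F with Interchange⇒Interchangeᴹ {G = G} {K} step
... | _ , _ , _ , _ , I = ⪯-InF steps (InFᴹ⇒InF K (interchange-InFᴹ I (InF⇒InFᴹ G F)))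

⪯-superdiagonal-≤ : ∀ {n} {G H : Graph n} → G ⪯ H → ∀ i → i < n → entries H i (suc i) ≤ entries G i (suc i)
⪯-superdiagonal-≤ ε              i i<n = ≤-refl
⪯-superdiagonal-≤ {G = G} (_◅_ {j = K} step steps) i i<n with Interchange⇒Interchangeᴹ {G = G} {K} step
... | _ , _ , _ , _ , I = ≤-trans (⪯-superdiagonal-≤ steps i i<n) (interchange-superdiagonal-≤ I i i<n)

-- Edge counts of G_b

count : ∀ {A : Set} → (A → ℕ) → List A → ℕ
count f []       = 0
count f (x ∷ xs) = f x + count f xs

count-++ : ∀ {A : Set} (f : A → ℕ) xs ys → count f (xs ++ ys) ≡ count f xs + count f ys
count-++ f []       ys = refl
count-++ f (x ∷ xs) ys = trans (cong (f x +_) (count-++ f xs ys)) (sym (+-assoc (f x) _ _))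

tails : ℕ → List (ℕ × ℕ) → ℕ
tails u = count (λ e → ⟦ u ≡ᵇ proj₁ e ⟧)

heads : ℕ → List (ℕ × ℕ) → ℕ
heads v = count (λ e → ⟦ v ≡ᵇ proj₂ e ⟧)

countE-++ : ∀ u v xs ys → countE u v (xs ++ ys) ≡ countE u v xs + countE u v ys
countE-++ u v []             ys = refl
countE-++ u v ((x , y) ∷ xs) ys = trans (cong (δ u v x y +_) (countE-++ u v xs ys)) (sym (+-assoc (δ u v x y) _ _))

-- An edge of a DAG on the vertices 1 … N (the 1-based labels used by Defs).
Proper : ℕ → ℕ × ℕ → Set
Proper N (x , y) = 1 ≤ x × x < y × y ≤ N

∑-countE-row : ∀ N u L → All (Proper N) L → ∑ N (λ j → countE u (suc j) L) ≡ tails u L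
∑-countE-row N u []               []                    = ∑-zero N (λ _ _ → refl)
∑-countE-row N u ((x , suc y) ∷ L) ((_ , _ , y<N) ∷ ps) =
  trans (∑-distrib-+ N (λ j → δ u j x y) (λ j → countE u (suc j) L))
        (cong₂ _+_ (∑-δ-row N u x y<N) (∑-countE-row N u L ps))

∑-countE-col : ∀ N v L → All (Proper N) L → ∑ N (λ i → countE (suc i) v L) ≡ heads v L
∑-countE-col N v []               []                     = ∑-zero N (λ _ _ → refl)
∑-countE-col N v ((suc x , y) ∷ L) ((_ , x<y , y≤N) ∷ ps) =
  trans (∑-distrib-+ N (λ i → δ i v x y) (λ i → countE (suc i) v L))
        (cong₂ _+_ (∑-δ-col N v y (≤-trans (<⇒≤ x<y) y≤N)) (∑-countE-col N v L ps))

countE-lower : ∀ N u v L → All (Proper N) L → v ≤ u → countE u v L ≡ 0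
countE-lower N u v []             []                  _   = refl
countE-lower N u v ((x , y) ∷ L) ((_ , x<y , _) ∷ ps) v≤u = cong₂ _+_ (δ-lower x<y v≤u) (countE-lower N u v L ps v≤u)

between : ℕ → ℕ → ℕ → ℕ
between s zero    u = 0
between s (suc m) u = ⟦ u ≡ᵇ s ⟧ + between (suc s) m u

between-below : ∀ s m u → u < s → between s m u ≡ 0
between-below s zero    u _   = refl
between-below s (suc m) u u<s rewrite ≢⇒≡ᵇ≡false (<⇒≢ u<s) = between-below (suc s) m u (≤-trans u<s (n≤1+n s))

between-above : ∀ s m u → s + m ≤ u → between s m u ≡ 0
between-above s zero    u _ = refl
between-above s (suc m) u s+1+m≤u
  rewrite ≢⇒≡ᵇ≡false {u} {s} (λ { refl → <-irrefl refl (≤-trans (s≤s (m≤m+n u m)) (≤-trans (≤-reflexive (sym (+-suc u m))) s+1+m≤u)) })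
  = between-above (suc s) m u (≤-trans (≤-reflexive (sym (+-suc s m))) s+1+m≤u)

between-inside : ∀ s m u → s ≤ u → u < s + m → between s m u ≡ 1
between-inside s zero    u s≤u u<s+0 = ⊥-elim (<⇒≱ u<s+0 (subst (_≤ u) (sym (+-identityʳ s)) s≤u))
between-inside s (suc m) u s≤u u<s+1+m with u ≟ s
... | yes refl rewrite ≡ᵇ-refl s = cong suc (between-below (suc s) m s ≤-refl)
... | no  u≢s rewrite ≢⇒≡ᵇ≡false u≢s =
  between-inside (suc s) m u (≤∧≢⇒< s≤u (u≢s ∘ sym)) (subst (u <_) (+-suc s m) u<s+1+m)

pathEdge : ℕ → ℕ × ℕ
pathEdge k = (suc k , k + 2)

-- Stated for any f agreeing with (s +_) rather than for upTo = applyUpTo id, so that the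
-- induction, which replaces f by f ∘ suc, goes through.
path-tails : ∀ m s (f : ℕ → ℕ) u → (∀ t → f t ≡ s + t) →
             tails u (map pathEdge (applyUpTo f m)) ≡ between (suc s) m u
path-tails zero    s f u _   = refl
path-tails (suc m) s f u f≗ =
  cong₂ _+_ (cong (λ z → ⟦ u ≡ᵇ suc z ⟧) (trans (f≗ 0) (+-identityʳ s)))
            (path-tails m (suc s) (f ∘ suc) u (λ t → trans (f≗ (suc t)) (+-suc s t)))

path-heads : ∀ m s (f : ℕ → ℕ) v → (∀ t → f t ≡ s + t) →
             heads v (map pathEdge (applyUpTo f m)) ≡ between (2 + s) m v
path-heads zero    s f v _   = refl
path-heads (suc m) s f v f≗ =
  cong₂ _+_ (cong (λ z → ⟦ v ≡ᵇ z ⟧) (trans (cong (_+ 2) (trans (f≗ 0) (+-identityʳ s))) (+-comm s 2)))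
            (path-heads m (suc s) (f ∘ suc) v (λ t → trans (f≗ (suc t)) (+-suc s t)))

path-superdiagonal : ∀ m s (f : ℕ → ℕ) i → (∀ t → f t ≡ s + t) →
                     countE (suc i) (suc (suc i)) (map pathEdge (applyUpTo f m)) ≡ between s m i
path-superdiagonal zero    s f i _   = refl
path-superdiagonal (suc m) s f i f≗ =
  cong₂ _+_ (trans (cong (λ z → δ (suc i) (suc (suc i)) (suc z) (z + 2)) (trans (f≗ 0) (+-identityʳ s))) head)
            (path-superdiagonal m (suc s) (f ∘ suc) i (λ t → trans (f≗ (suc t)) (+-suc s t)))
  where
  head : δ (suc i) (suc (suc i)) (suc s) (s + 2) ≡ ⟦ i ≡ᵇ s ⟧
  head rewrite +-comm s 2 = cong ⟦_⟧ (∧-idem (i ≡ᵇ s))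

path-Proper : ∀ n → All (Proper (suc n)) (map pathEdge (upTo n))
path-Proper n = map⁺ (applyUpTo⁺₁ (λ x → x) n (λ {i} i<n →
  s≤s z≤n , ≤-reflexive (sym (+-comm i 2)) , subst (_≤ suc n) (sym (+-comm i 2)) (s≤s i<n)))

-- Every position l of b passes exactly one tail l+1 and one head l+2 to zeroEdges or to
-- chainEdges: an extra edge (l+1, l+2) if b_l = 0, and if b_l = 1 the chain edge ending
-- at l+2 while the next chain edge starts at l+1.
zero-chain-tails : ∀ {m} (b : Vec Bool m) p l u N →
  tails u (zeroEdges l (toList b)) + tails u (chainEdges p l (toList b) N) ≡ ⟦ u ≡ᵇ p ⟧ + between (suc l) m u
zero-chain-tails [] p l u N = refl
zero-chain-tails {suc m} (true ∷ b) p l u N = begin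
  tails u (zeroEdges (suc l) (toList b)) + (⟦ u ≡ᵇ p ⟧ + tails u (chainEdges (l + 1) (suc l) (toList b) N))
    ≡⟨ x∙yz≈y∙xz (tails u (zeroEdges (suc l) (toList b))) ⟦ u ≡ᵇ p ⟧ (tails u (chainEdges (l + 1) (suc l) (toList b) N)) ⟩
  ⟦ u ≡ᵇ p ⟧ + (tails u (zeroEdges (suc l) (toList b)) + tails u (chainEdges (l + 1) (suc l) (toList b) N))
    ≡⟨ cong (⟦ u ≡ᵇ p ⟧ +_) (zero-chain-tails b (l + 1) (suc l) u N) ⟩
  ⟦ u ≡ᵇ p ⟧ + (⟦ u ≡ᵇ l + 1 ⟧ + between (2 + l) m u)
    ≡⟨ cong (λ z → ⟦ u ≡ᵇ p ⟧ + (⟦ u ≡ᵇ z ⟧ + between (2 + l) m u)) (+-comm l 1) ⟩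
  ⟦ u ≡ᵇ p ⟧ + between (suc l) (suc m) u ∎
  where open ≡-Reasoning
zero-chain-tails {suc m} (false ∷ b) p l u N = begin
  ⟦ u ≡ᵇ l + 1 ⟧ + tails u (zeroEdges (suc l) (toList b)) + tails u (chainEdges p (suc l) (toList b) N)
    ≡⟨ +-assoc ⟦ u ≡ᵇ l + 1 ⟧ (tails u (zeroEdges (suc l) (toList b))) (tails u (chainEdges p (suc l) (toList b) N)) ⟩
  ⟦ u ≡ᵇ l + 1 ⟧ + (tails u (zeroEdges (suc l) (toList b)) + tails u (chainEdges p (suc l) (toList b) N))
    ≡⟨ cong (⟦ u ≡ᵇ l + 1 ⟧ +_) (zero-chain-tails b p (suc l) u N) ⟩
  ⟦ u ≡ᵇ l + 1 ⟧ + (⟦ u ≡ᵇ p ⟧ + between (2 + l) m u)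
    ≡⟨ x∙yz≈y∙xz ⟦ u ≡ᵇ l + 1 ⟧ ⟦ u ≡ᵇ p ⟧ (between (2 + l) m u) ⟩
  ⟦ u ≡ᵇ p ⟧ + (⟦ u ≡ᵇ l + 1 ⟧ + between (2 + l) m u)
    ≡⟨ cong (λ z → ⟦ u ≡ᵇ p ⟧ + (⟦ u ≡ᵇ z ⟧ + between (2 + l) m u)) (+-comm l 1) ⟩
  ⟦ u ≡ᵇ p ⟧ + between (suc l) (suc m) u ∎
  where open ≡-Reasoning

heads-step : ∀ m l v N → ⟦ v ≡ᵇ l + 2 ⟧ + (⟦ v ≡ᵇ suc N ⟧ + between (3 + l) m v) ≡ ⟦ v ≡ᵇ suc N ⟧ + between (2 + l) (suc m) v
heads-step m l v N = trans (x∙yz≈y∙xz ⟦ v ≡ᵇ l + 2 ⟧ ⟦ v ≡ᵇ suc N ⟧ (between (3 + l) m v))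
                           (cong (λ z → ⟦ v ≡ᵇ suc N ⟧ + (⟦ v ≡ᵇ z ⟧ + between (3 + l) m v)) (+-comm l 2))

zero-chain-heads : ∀ {m} (b : Vec Bool m) p l v N →
  heads v (zeroEdges l (toList b)) + heads v (chainEdges p l (toList b) N) ≡ ⟦ v ≡ᵇ suc N ⟧ + between (2 + l) m v
zero-chain-heads [] p l v N = refl
zero-chain-heads {suc m} (true ∷ b) p l v N = begin
  heads v (zeroEdges (suc l) (toList b)) + (⟦ v ≡ᵇ l + 2 ⟧ + heads v (chainEdges (l + 1) (suc l) (toList b) N))
    ≡⟨ x∙yz≈y∙xz (heads v (zeroEdges (suc l) (toList b))) ⟦ v ≡ᵇ l + 2 ⟧ (heads v (chainEdges (l + 1) (suc l) (toList b) N)) ⟩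
  ⟦ v ≡ᵇ l + 2 ⟧ + (heads v (zeroEdges (suc l) (toList b)) + heads v (chainEdges (l + 1) (suc l) (toList b) N))
    ≡⟨ cong (⟦ v ≡ᵇ l + 2 ⟧ +_) (zero-chain-heads b (l + 1) (suc l) v N) ⟩
  ⟦ v ≡ᵇ l + 2 ⟧ + (⟦ v ≡ᵇ suc N ⟧ + between (3 + l) m v)
    ≡⟨ heads-step m l v N ⟩
  ⟦ v ≡ᵇ suc N ⟧ + between (2 + l) (suc m) v ∎
  where open ≡-Reasoning
zero-chain-heads {suc m} (false ∷ b) p l v N = begin
  ⟦ v ≡ᵇ l + 2 ⟧ + heads v (zeroEdges (suc l) (toList b)) + heads v (chainEdges p (suc l) (toList b) N)
    ≡⟨ +-assoc ⟦ v ≡ᵇ l + 2 ⟧ (heads v (zeroEdges (suc l) (toList b))) (heads v (chainEdges p (suc l) (toList b) N)) ⟩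
  ⟦ v ≡ᵇ l + 2 ⟧ + (heads v (zeroEdges (suc l) (toList b)) + heads v (chainEdges p (suc l) (toList b) N))
    ≡⟨ cong (⟦ v ≡ᵇ l + 2 ⟧ +_) (zero-chain-heads b p (suc l) v N) ⟩
  ⟦ v ≡ᵇ l + 2 ⟧ + (⟦ v ≡ᵇ suc N ⟧ + between (3 + l) m v)
    ≡⟨ heads-step m l v N ⟩
  ⟦ v ≡ᵇ suc N ⟧ + between (2 + l) (suc m) v ∎
  where open ≡-Reasoning

Outside : ℕ → ℕ → ℕ → Set
Outside l m x = x < l ⊎ l + m ≤ x

Outside-step : ∀ l m x → Outside l (suc m) x → Outside (suc l) m x
Outside-step l m x = Sum.map (λ x<l → ≤-trans x<l (n≤1+n l)) (≤-trans (≤-reflexive (sym (+-suc l m))))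

Outside⇒≢ : ∀ l m x → Outside l (suc m) x → ¬ x ≡ l
Outside⇒≢ l m x (inj₁ x<l)     refl = <-irrefl refl x<l
Outside⇒≢ l m x (inj₂ l+1+m≤x) refl = <⇒≱ (m<m+n l (s≤s z≤n)) l+1+m≤x

zeroEdges-superdiagonal-outside : ∀ {m} (b : Vec Bool m) l x → Outside l m x →
                                  countE (suc x) (suc (suc x)) (zeroEdges l (toList b)) ≡ 0
zeroEdges-superdiagonal-outside []                l x _   = refl
zeroEdges-superdiagonal-outside {suc m} (true ∷ b)  l x out =
  zeroEdges-superdiagonal-outside b (suc l) x (Outside-step l m x out)
zeroEdges-superdiagonal-outside {suc m} (false ∷ b) l x out =
  cong₂ _+_ (δ-≢ˡ (suc (suc x)) (l + 2) (λ 1+x≡l+1 → Outside⇒≢ l m x out (suc-injective (trans 1+x≡l+1 (+-comm l 1)))))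
            (zeroEdges-superdiagonal-outside b (suc l) x (Outside-step l m x out))

zeroEdges-superdiagonal : ∀ {m} (b : Vec Bool m) l i → i < m →
  suc (countE (suc (l + i)) (suc (suc (l + i))) (zeroEdges l (toList b))) ≡ superdiagonal b (suc i)
zeroEdges-superdiagonal (true ∷ b) l zero _ =
  cong suc (zeroEdges-superdiagonal-outside b (suc l) (l + 0) (inj₁ (s≤s (≤-reflexive (+-identityʳ l)))))
zeroEdges-superdiagonal (false ∷ b) l zero _ =
  cong suc (cong₂ _+_ extra (zeroEdges-superdiagonal-outside b (suc l) (l + 0) (inj₁ (s≤s (≤-reflexive (+-identityʳ l))))))
  where
  extra : δ (suc (l + 0)) (suc (suc (l + 0))) (l + 1) (l + 2) ≡ 1
  extra rewrite +-identityʳ l | +-comm l 1 | +-comm l 2 = δ-diag (suc l) (2 + l)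
zeroEdges-superdiagonal (x ∷ b) l (suc i) (s≤s i<m) rewrite +-suc l i with x
... | true  = zeroEdges-superdiagonal b (suc l) i i<m
... | false = trans (cong (λ x → suc (x + countE (suc (suc (l + i))) (suc (suc (suc (l + i)))) (zeroEdges (suc l) (toList b))))
                          (δ-≢ˡ (suc (suc (suc (l + i)))) (l + 2) 2+l+i≢l+1))
                    (zeroEdges-superdiagonal b (suc l) i i<m)
  where
  2+l+i≢l+1 : ¬ suc (suc (l + i)) ≡ l + 1
  2+l+i≢l+1 eq = m≢1+m+n l (sym (suc-injective (trans eq (+-comm l 1))))

chainEdges-superdiagonal : ∀ {m} (b : Vec Bool m) p l N x → p ≤ l → l + m < N →
                           countE (suc x) (suc (suc x)) (chainEdges p l (toList b) N) ≡ 0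
chainEdges-superdiagonal [] p l N x p≤l l+0<N =
  cong (_+ 0) (δ-superdiagonal (suc x) (s≤s (≤-trans (s≤s p≤l) (subst (_< N) (+-identityʳ l) l+0<N))))
chainEdges-superdiagonal {suc m} (true ∷ b) p l N x p≤l l+m<N =
  cong₂ _+_ (δ-superdiagonal (suc x) (subst (suc p <_) (sym (+-comm l 2)) (s≤s (s≤s p≤l))))
            (chainEdges-superdiagonal b (l + 1) (suc l) N x (≤-reflexive (+-comm l 1)) (subst (_< N) (+-suc l m) l+m<N))
chainEdges-superdiagonal {suc m} (false ∷ b) p l N x p≤l l+m<N =
  chainEdges-superdiagonal b p (suc l) N x (≤-trans p≤l (n≤1+n l)) (subst (_< N) (+-suc l m) l+m<N)

zeroEdges-Proper : ∀ {m} (b : Vec Bool m) l n → l + m < n → All (Proper (suc n)) (zeroEdges l (toList b))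
zeroEdges-Proper [] l n _ = []
zeroEdges-Proper {suc m} (true ∷ b) l n l+m<n = zeroEdges-Proper b (suc l) n (subst (_< n) (+-suc l m) l+m<n)
zeroEdges-Proper {suc m} (false ∷ b) l n l+m<n =
  (subst (1 ≤_) (sym (+-comm l 1)) (s≤s z≤n) ,
   subst₂ _<_ (sym (+-comm l 1)) (sym (+-comm l 2)) ≤-refl ,
   subst (_≤ suc n) (sym (+-comm l 2)) (s≤s (≤-trans (s≤s (m≤m+n l m)) (<⇒≤ l+1+m<n))))
  ∷ zeroEdges-Proper b (suc l) n l+1+m<n
  where
  l+1+m<n : suc l + m < n
  l+1+m<n = subst (_< n) (+-suc l m) l+m<n

chainEdges-Proper : ∀ {m} (b : Vec Bool m) p l n → 1 ≤ p → p ≤ l → l + m < suc n →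
                    All (Proper (suc n)) (chainEdges p l (toList b) n)
chainEdges-Proper [] p l n 1≤p p≤l l+0<1+n =
  (1≤p , ≤-trans (s≤s p≤l) (subst (_< suc n) (+-identityʳ l) l+0<1+n) , ≤-refl) ∷ []
chainEdges-Proper {suc m} (true ∷ b) p l n 1≤p p≤l l+m<1+n =
  (1≤p , subst (p <_) (sym (+-comm l 2)) (s≤s (≤-trans p≤l (n≤1+n l))) ,
   subst (_≤ suc n) (sym (+-comm l 2)) (≤-trans (s≤s (s≤s (m≤m+n l m))) l+1+m<1+n))
  ∷ chainEdges-Proper b (l + 1) (suc l) n (subst (1 ≤_) (sym (+-comm l 1)) (s≤s z≤n)) (≤-reflexive (+-comm l 1)) l+1+m<1+n
  where
  l+1+m<1+n : suc l + m < suc n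
  l+1+m<1+n = subst (_< suc n) (+-suc l m) l+m<1+n
chainEdges-Proper {suc m} (false ∷ b) p l n 1≤p p≤l l+m<1+n =
  chainEdges-Proper b p (suc l) n 1≤p (≤-trans p≤l (n≤1+n l)) (subst (_< suc n) (+-suc l m) l+m<1+n)

edges : ∀ {k} → Vec Bool k → List (ℕ × ℕ)
edges {k} b = edgesG (2 + k) (toList b)

Gᴹ : ∀ {k} → Vec Bool k → Matrix
Gᴹ b i j = countE (suc i) (suc j) (edges b)

entries-G : ∀ {k} (b : Vec Bool k) → entries (G[_] {2 + k} b) ≈[ 2 + k ] Gᴹ b
entries-G b = entries-tabulate² (Gᴹ b)

edges-Proper : ∀ {k} (b : Vec Bool k) → All (Proper (3 + k)) (edges b)
edges-Proper {k} b = ++⁺ (path-Proper (2 + k))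
  ((s≤s z≤n , ≤-refl , s≤s (s≤s z≤n)) ∷ (s≤s z≤n , ≤-refl , ≤-refl) ∷
   ++⁺ (zeroEdges-Proper b 1 (2 + k) ≤-refl) (chainEdges-Proper b 1 1 (2 + k) (s≤s z≤n) ≤-refl (n≤1+n _)))

tails-edges : ∀ {k} (b : Vec Bool k) i →
  tails (suc i) (edges b) ≡ between 1 (2 + k) (suc i) + (⟦ i ≡ᵇ 0 ⟧ + (⟦ i ≡ᵇ suc k ⟧ + (⟦ i ≡ᵇ 0 ⟧ + between 2 k (suc i))))
tails-edges {k} b i = begin
  tails (suc i) (edges b)
    ≡⟨ count-++ tail (map pathEdge (upTo (2 + k))) _ ⟩
  tails (suc i) (map pathEdge (upTo (2 + k))) + (⟦ i ≡ᵇ 0 ⟧ + (⟦ i ≡ᵇ suc k ⟧ + tails (suc i) (Z ++ C)))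
    ≡⟨ cong₂ _+_ (path-tails (2 + k) 0 (λ t → t) (suc i) (λ _ → refl))
                 (cong (λ z → ⟦ i ≡ᵇ 0 ⟧ + (⟦ i ≡ᵇ suc k ⟧ + z)) (trans (count-++ tail Z C) (zero-chain-tails b 1 1 (suc i) (2 + k)))) ⟩
  between 1 (2 + k) (suc i) + (⟦ i ≡ᵇ 0 ⟧ + (⟦ i ≡ᵇ suc k ⟧ + (⟦ i ≡ᵇ 0 ⟧ + between 2 k (suc i)))) ∎
  where
  open ≡-Reasoning
  tail : ℕ × ℕ → ℕ
  tail e = ⟦ suc i ≡ᵇ proj₁ e ⟧
  Z C : List (ℕ × ℕ)
  Z = zeroEdges 1 (toList b)
  C = chainEdges 1 1 (toList b) (2 + k)

heads-edges : ∀ {k} (b : Vec Bool k) j →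
  heads (suc j) (edges b) ≡ between 2 (2 + k) (suc j) + (⟦ j ≡ᵇ 1 ⟧ + (⟦ j ≡ᵇ 2 + k ⟧ + (⟦ j ≡ᵇ 2 + k ⟧ + between 3 k (suc j))))
heads-edges {k} b j = begin
  heads (suc j) (edges b)
    ≡⟨ count-++ head (map pathEdge (upTo (2 + k))) _ ⟩
  heads (suc j) (map pathEdge (upTo (2 + k))) + (⟦ j ≡ᵇ 1 ⟧ + (⟦ j ≡ᵇ 2 + k ⟧ + heads (suc j) (Z ++ C)))
    ≡⟨ cong₂ _+_ (path-heads (2 + k) 0 (λ t → t) (suc j) (λ _ → refl))
                 (cong (λ z → ⟦ j ≡ᵇ 1 ⟧ + (⟦ j ≡ᵇ 2 + k ⟧ + z)) (trans (count-++ head Z C) (zero-chain-heads b 1 1 (suc j) (2 + k)))) ⟩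
  between 2 (2 + k) (suc j) + (⟦ j ≡ᵇ 1 ⟧ + (⟦ j ≡ᵇ 2 + k ⟧ + (⟦ j ≡ᵇ 2 + k ⟧ + between 3 k (suc j)))) ∎
  where
  open ≡-Reasoning
  head : ℕ × ℕ → ℕ
  head e = ⟦ suc j ≡ᵇ proj₂ e ⟧
  Z C : List (ℕ × ℕ)
  Z = zeroEdges 1 (toList b)
  C = chainEdges 1 1 (toList b) (2 + k)

tails-edges-value : ∀ k i → i ≤ 2 + k →
  between 1 (2 + k) (suc i) + (⟦ i ≡ᵇ 0 ⟧ + (⟦ i ≡ᵇ suc k ⟧ + (⟦ i ≡ᵇ 0 ⟧ + between 2 k (suc i)))) ≡ outSpecℕ (2 + k) i
tails-edges-value k zero _ =
  cong₂ (λ x y → x + (1 + (0 + (1 + y)))) (between-inside 1 (2 + k) 1 ≤-refl (s≤s (s≤s z≤n))) (between-below 2 k 1 ≤-refl)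
tails-edges-value k (suc i) (s≤s i≤1+k) with m≤n⇒m<n∨m≡n i≤1+k
... | inj₂ refl = begin
  between 1 (2 + k) (3 + k) + (0 + (⟦ suc k ≡ᵇ k ⟧ + (0 + between 2 k (3 + k))))
    ≡⟨ cong₂ (λ x y → x + (⟦ suc k ≡ᵇ k ⟧ + y)) (between-above 1 (2 + k) (3 + k) ≤-refl) (between-above 2 k (3 + k) (n≤1+n _)) ⟩
  ⟦ suc k ≡ᵇ k ⟧ + 0            ≡⟨ cong (λ b → ⟦ b ⟧ + 0) (≢⇒≡ᵇ≡false (1+n≢n {k})) ⟩
  0                             ≡⟨ cong (λ b → if b then 0 else 2) (sym (≡ᵇ-refl k)) ⟩
  outSpecℕ (2 + k) (2 + k)      ∎
  where open ≡-Reasoning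
... | inj₁ (s≤s i≤k) with m≤n⇒m<n∨m≡n i≤k
...   | inj₂ refl = begin
  between 1 (2 + k) (2 + k) + (0 + (⟦ k ≡ᵇ k ⟧ + (0 + between 2 k (2 + k))))
    ≡⟨ cong₂ (λ x y → x + (⟦ k ≡ᵇ k ⟧ + y)) (between-inside 1 (2 + k) (2 + k) (s≤s z≤n) ≤-refl) (between-above 2 k (2 + k) ≤-refl) ⟩
  1 + (⟦ k ≡ᵇ k ⟧ + 0)          ≡⟨ cong (λ b → 1 + (⟦ b ⟧ + 0)) (≡ᵇ-refl k) ⟩
  2                             ≡⟨ cong (λ b → if b then 0 else 2) (sym (≢⇒≡ᵇ≡false (<⇒≢ (n<1+n k)))) ⟩
  outSpecℕ (2 + k) (suc k)      ∎
  where open ≡-Reasoning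
...   | inj₁ i<k = begin
  between 1 (2 + k) (2 + i) + (0 + (⟦ i ≡ᵇ k ⟧ + (0 + between 2 k (2 + i))))
    ≡⟨ cong₂ (λ x y → x + (⟦ i ≡ᵇ k ⟧ + y)) (between-inside 1 (2 + k) (2 + i) (s≤s z≤n) (s≤s (s≤s (s≤s (<⇒≤ i<k)))))
                                             (between-inside 2 k (2 + i) (s≤s (s≤s z≤n)) (s≤s (s≤s i<k))) ⟩
  1 + (⟦ i ≡ᵇ k ⟧ + 1)          ≡⟨ cong (λ b → 1 + (⟦ b ⟧ + 1)) (≢⇒≡ᵇ≡false (<⇒≢ i<k)) ⟩
  2                             ≡⟨ cong (λ b → if b then 0 else 2) (sym (≢⇒≡ᵇ≡false (<⇒≢ (≤-trans i<k (n≤1+n k))))) ⟩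
  outSpecℕ (2 + k) (suc i)      ∎
  where open ≡-Reasoning

heads-edges-value : ∀ k j → j ≤ 2 + k →
  between 2 (2 + k) (suc j) + (⟦ j ≡ᵇ 1 ⟧ + (⟦ j ≡ᵇ 2 + k ⟧ + (⟦ j ≡ᵇ 2 + k ⟧ + between 3 k (suc j)))) ≡ inSpecℕ (2 + k) j
heads-edges-value k zero _ =
  cong₂ (λ x y → x + (0 + (0 + (0 + y)))) (between-below 2 (2 + k) 1 ≤-refl) (between-below 3 k 1 (s≤s (s≤s z≤n)))
heads-edges-value k (suc zero) _ =
  cong₂ (λ x y → x + (1 + (0 + (0 + y)))) (between-inside 2 (2 + k) 2 ≤-refl (s≤s (s≤s (s≤s z≤n)))) (between-below 3 k 2 ≤-refl)
heads-edges-value k (suc (suc j)) (s≤s (s≤s j≤k)) with m≤n⇒m<n∨m≡n j≤k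
... | inj₂ refl = begin
  between 2 (2 + j) (3 + j) + (0 + (⟦ j ≡ᵇ j ⟧ + (⟦ j ≡ᵇ j ⟧ + between 3 j (3 + j))))
    ≡⟨ cong₂ (λ x y → x + (⟦ j ≡ᵇ j ⟧ + (⟦ j ≡ᵇ j ⟧ + y))) (between-inside 2 (2 + j) (3 + j) (s≤s (s≤s z≤n)) ≤-refl)
                                                          (between-above 3 j (3 + j) ≤-refl) ⟩
  1 + (⟦ j ≡ᵇ j ⟧ + (⟦ j ≡ᵇ j ⟧ + 0))   ≡⟨ cong (λ b → 1 + (⟦ b ⟧ + (⟦ b ⟧ + 0))) (≡ᵇ-refl j) ⟩
  3                                     ≡⟨ cong (λ b → if b then 3 else 2) (sym (≡ᵇ-refl j)) ⟩
  inSpecℕ (2 + j) (2 + j)               ∎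
  where open ≡-Reasoning
... | inj₁ j<k = begin
  between 2 (2 + k) (3 + j) + (0 + (⟦ j ≡ᵇ k ⟧ + (⟦ j ≡ᵇ k ⟧ + between 3 k (3 + j))))
    ≡⟨ cong₂ (λ x y → x + (⟦ j ≡ᵇ k ⟧ + (⟦ j ≡ᵇ k ⟧ + y))) (between-inside 2 (2 + k) (3 + j) (s≤s (s≤s z≤n)) (s≤s (s≤s (s≤s (s≤s (<⇒≤ j<k))))))
                                                          (between-inside 3 k (3 + j) (s≤s (s≤s (s≤s z≤n))) (s≤s (s≤s (s≤s j<k)))) ⟩
  1 + (⟦ j ≡ᵇ k ⟧ + (⟦ j ≡ᵇ k ⟧ + 1))   ≡⟨ cong (λ b → 1 + (⟦ b ⟧ + (⟦ b ⟧ + 1))) (≢⇒≡ᵇ≡false (<⇒≢ j<k)) ⟩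
  2                                     ≡⟨ cong (λ b → if b then 3 else 2) (sym (≢⇒≡ᵇ≡false (<⇒≢ j<k))) ⟩
  inSpecℕ (2 + k) (2 + j)               ∎
  where open ≡-Reasoning

Gᴹ-InFᴹ : ∀ {k} (b : Vec Bool k) → InFᴹ (2 + k) (Gᴹ b)
Gᴹ-InFᴹ {k} b = record
  { upper  = λ i j _ _ j≤i → countE-lower (3 + k) (suc i) (suc j) (edges b) (edges-Proper b) (s≤s j≤i)
  ; rowSum = λ i i≤ → trans (∑-countE-row (3 + k) (suc i) (edges b) (edges-Proper b))
                            (trans (tails-edges b i) (tails-edges-value k i i≤))
  ; colSum = λ j j≤ → trans (∑-countE-col (3 + k) (suc j) (edges b) (edges-Proper b))
                            (trans (heads-edges b j) (heads-edges-value k j j≤))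
  }

edges-superdiagonal : ∀ {k} (b : Vec Bool k) i →
  Gᴹ b i (suc i) ≡ between 0 (2 + k) i + (⟦ i ≡ᵇ 0 ⟧ + (⟦ i ≡ᵇ suc k ⟧ + countE (suc i) (suc (suc i)) (zeroEdges 1 (toList b))))
edges-superdiagonal {k} b i = begin
  Gᴹ b i (suc i)
    ≡⟨ countE-++ (suc i) (suc (suc i)) (map pathEdge (upTo (2 + k))) _ ⟩
  countE (suc i) (suc (suc i)) (map pathEdge (upTo (2 + k)))
    + (⟦ (i ≡ᵇ 0) ∧ (i ≡ᵇ 0) ⟧ + (⟦ (i ≡ᵇ suc k) ∧ (i ≡ᵇ suc k) ⟧ + countE (suc i) (suc (suc i)) (Z ++ C)))
    ≡⟨ cong₂ _+_ (path-superdiagonal (2 + k) 0 (λ t → t) i (λ _ → refl))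
                 (cong₂ (λ x y → ⟦ x ⟧ + (⟦ y ⟧ + countE (suc i) (suc (suc i)) (Z ++ C))) (∧-idem (i ≡ᵇ 0)) (∧-idem (i ≡ᵇ suc k))) ⟩
  between 0 (2 + k) i + (⟦ i ≡ᵇ 0 ⟧ + (⟦ i ≡ᵇ suc k ⟧ + countE (suc i) (suc (suc i)) (Z ++ C)))
    ≡⟨ cong (λ z → between 0 (2 + k) i + (⟦ i ≡ᵇ 0 ⟧ + (⟦ i ≡ᵇ suc k ⟧ + z))) zeroEdges-only ⟩
  between 0 (2 + k) i + (⟦ i ≡ᵇ 0 ⟧ + (⟦ i ≡ᵇ suc k ⟧ + countE (suc i) (suc (suc i)) Z)) ∎
  where
  open ≡-Reasoning
  Z C : List (ℕ × ℕ)
  Z = zeroEdges 1 (toList b)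
  C = chainEdges 1 1 (toList b) (2 + k)
  zeroEdges-only : countE (suc i) (suc (suc i)) (Z ++ C) ≡ countE (suc i) (suc (suc i)) Z
  zeroEdges-only = trans (countE-++ (suc i) (suc (suc i)) Z C)
    (trans (cong (countE (suc i) (suc (suc i)) Z +_) (chainEdges-superdiagonal b 1 1 (2 + k) i ≤-refl ≤-refl))
           (+-identityʳ _))

Gᴹ-superdiagonal : ∀ {k} (b : Vec Bool k) i → i < 2 + k → Gᴹ b i (suc i) ≡ superdiagonal b i
Gᴹ-superdiagonal {k} b zero _ = trans (edges-superdiagonal b 0)
  (cong₂ (λ x y → x + (1 + (0 + y))) (between-inside 0 (2 + k) 0 z≤n (s≤s z≤n))
                                     (zeroEdges-superdiagonal-outside b 1 0 (inj₁ ≤-refl)))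
Gᴹ-superdiagonal {k} b (suc i) (s≤s (s≤s i≤k)) with m≤n⇒m<n∨m≡n i≤k
... | inj₂ refl = trans (edges-superdiagonal b (suc k))
  (trans (cong₂ (λ x z → x + (0 + (⟦ k ≡ᵇ k ⟧ + z))) (between-inside 0 (2 + k) (suc k) z≤n ≤-refl)
                                                    (zeroEdges-superdiagonal-outside b 1 (suc k) (inj₂ ≤-refl)))
  (trans (cong (λ y → 1 + (0 + (⟦ y ⟧ + 0))) (≡ᵇ-refl k))
         (sym (superdiagonal-last b))))
... | inj₁ i<k = trans (edges-superdiagonal b (suc i))
  (trans (cong₂ (λ x y → x + (0 + (⟦ y ⟧ + countE (2 + i) (3 + i) (zeroEdges 1 (toList b)))))
                (between-inside 0 (2 + k) (suc i) z≤n (s≤s (s≤s (<⇒≤ i<k)))) (≢⇒≡ᵇ≡false (<⇒≢ i<k)))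
         (zeroEdges-superdiagonal b 1 i i<k))

-- The poset 𝓕_{n,3}

≤⇒<2+ : ∀ {i k} → i ≤ k → i < 2 + k
≤⇒<2+ {k = k} i≤k = s≤s (≤-trans i≤k (n≤1+n k))

G-InF : ∀ {k} (b : Vec Bool k) → InF (2 + k) (G[_] {2 + k} b)
G-InF {k} b = InFᴹ⇒InF (G[_] {2 + k} b) (InFᴹ-resp (λ i j i≤ j≤ → sym (entries-G b i j i≤ j≤)) (Gᴹ-InFᴹ b))

G-superdiagonal : ∀ {k} (b : Vec Bool k) i → i < 2 + k → entries (G[_] {2 + k} b) i (suc i) ≡ superdiagonal b i
G-superdiagonal b i i<2+k = trans (entries-G b i (suc i) (<⇒≤ i<2+k) i<2+k) (Gᴹ-superdiagonal b i i<2+k)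

Raise⇒Interchange : ∀ {k} {b b′ : Vec Bool k} → Raise b b′ → Interchange (G[_] {2 + k} b) (G[_] {2 + k} b′)
Raise⇒Interchange {k} {b} {b′} r with Raise-superdiagonal r
... | l , 1≤l , l≤k , b≡2 , b′≡1 , elsewhere
  with spanning-edge k (Gᴹ-InFᴹ b) l 1≤l l≤k (trans (Gᴹ-superdiagonal b l (≤⇒<2+ l≤k)) b≡2)
... | a , d , a<l , 1+l<d , d≤2+k , 1≤Mad =
  Interchangeᴹ⇒Interchange {G = G[_] {2 + k} b} {G[_] {2 + k} b′}
    (Interchangeᴹ-resp I (λ i j i≤ j≤ → sym (entries-G b i j i≤ j≤))
                         (λ i j i≤ j≤ → trans (M′≈Gb′ i j i≤ j≤) (sym (entries-G b′ i j i≤ j≤))))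
  where
  l<2+k : l < 2 + k
  l<2+k = ≤⇒<2+ l≤k
  Ml≡2 : Gᴹ b l (suc l) ≡ 2
  Ml≡2 = trans (Gᴹ-superdiagonal b l l<2+k) b≡2
  I : Interchangeᴹ (2 + k) (Gᴹ b) (interchanged (Gᴹ b) a l (suc l) d) a l (suc l) d
  I = interchanged-Interchangeᴹ a<l ≤-refl 1+l<d d≤2+k 1≤Mad (subst (1 ≤_) (sym Ml≡2) (s≤s z≤n))
  M′ : Matrix
  M′ = interchanged (Gᴹ b) a l (suc l) d
  same : SameSuperdiagonal (2 + k) M′ (Gᴹ b′)
  same i i<2+k with i ≟ l
  ... | yes refl = +-cancelʳ-≡ 1 _ _ (begin
    M′ l (suc l) + 1    ≡⟨ interchange-superdiagonal-at I l<2+k ⟩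
    Gᴹ b l (suc l)      ≡⟨ Ml≡2 ⟩
    2                   ≡⟨ cong (_+ 1) (sym (trans (Gᴹ-superdiagonal b′ l l<2+k) b′≡1)) ⟩
    Gᴹ b′ l (suc l) + 1 ∎)
    where open ≡-Reasoning
  ... | no  i≢l = begin
    M′ i (suc i)        ≡⟨ interchange-superdiagonal-≢ I i i<2+k i≢l ⟩
    Gᴹ b i (suc i)      ≡⟨ Gᴹ-superdiagonal b i i<2+k ⟩
    superdiagonal b i   ≡⟨ elsewhere i i≢l ⟩
    superdiagonal b′ i  ≡⟨ sym (Gᴹ-superdiagonal b′ i i<2+k) ⟩
    Gᴹ b′ i (suc i)     ∎
    where open ≡-Reasoning
  M′≈Gb′ : M′ ≈[ 2 + k ] Gᴹ b′
  M′≈Gb′ = superdiagonal-determines k (interchange-InFᴹ I (Gᴹ-InFᴹ b)) (Gᴹ-InFᴹ b′) same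

G-monotone : ∀ {k} {b b′ : Vec Bool k} → Pointwise B._≤_ b b′ → G[_] {2 + k} b ⪯ G[ b′ ]
G-monotone b≤b′ = gmap G[_] Raise⇒Interchange (Pointwise-≤⇒Raise* b≤b′)

G-reflects : ∀ {k} (b b′ : Vec Bool k) → G[_] {2 + k} b ⪯ G[ b′ ] → Pointwise B._≤_ b b′
G-reflects {k} b b′ Gb⪯Gb′ = superdiagonal-antitone b b′ λ i _ i≤k →
  subst₂ _≤_ (G-superdiagonal b′ i (≤⇒<2+ i≤k)) (G-superdiagonal b i (≤⇒<2+ i≤k)) (⪯-superdiagonal-≤ Gb⪯Gb′ i (≤⇒<2+ i≤k))

G-injective : ∀ {k} (b b′ : Vec Bool k) → G[_] {2 + k} b ≡ G[ b′ ] → b ≡ b′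
G-injective {k} b b′ Gb≡Gb′ = superdiagonal-injective b b′ λ i _ i≤k →
  trans (sym (G-superdiagonal b i (≤⇒<2+ i≤k)))
        (trans (cong (λ G → entries G i (suc i)) Gb≡Gb′) (G-superdiagonal b′ i (≤⇒<2+ i≤k)))

G-surjective : ∀ {k} (G : Graph (2 + k)) → InF (2 + k) G → ∃[ b ] G[_] {2 + k} b ≡ G
G-surjective {k} G G∈F = b , ≈⇒≡ G[ b ] G (superdiagonal-determines k (InF⇒InFᴹ G[ b ] (G-InF b)) F same)
  where
  F : InFᴹ (2 + k) (entries G)
  F = InF⇒InFᴹ G G∈F
  M : Matrix
  M = entries G
  b : Vec Bool k
  b = bitsOf k (λ i → M i (suc i))
  same : SameSuperdiagonal (2 + k) (entries (G[_] {2 + k} b)) M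
  same zero _ = trans (G-superdiagonal b 0 (s≤s z≤n)) (sym (M01≡2 F))
  same (suc i) 1+i<2+k@(s≤s (s≤s i≤k)) with m≤n⇒m<n∨m≡n i≤k
  ... | inj₂ refl = trans (G-superdiagonal b (suc k) 1+i<2+k) (trans (superdiagonal-last b) (sym (last-superdiagonal k F)))
  ... | inj₁ i<k  = trans (G-superdiagonal b (suc i) 1+i<2+k)
                          (superdiagonal-bitsOf k (λ i → M i (suc i)) (inner-superdiagonal k F) (suc i) (s≤s z≤n) i<k)

⪯-antisym : ∀ {k} (G H : Graph (2 + k)) → InF (2 + k) G → InF (2 + k) H → G ⪯ H → H ⪯ G → G ≡ H
⪯-antisym {k} G H G∈F H∈F G⪯H H⪯G = ≈⇒≡ G H
  (superdiagonal-determines k (InF⇒InFᴹ G G∈F) (InF⇒InFᴹ H H∈F)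
    (λ i i<n → ≤-antisym (⪯-superdiagonal-≤ H⪯G i i<n) (⪯-superdiagonal-≤ G⪯H i i<n)))

corollary3p21 : (n : ℕ) → 2 ≤ n →
    ((∀ G → InF n G → G ⪯ G)
    × (∀ G H K → InF n G → InF n H → InF n K → G ⪯ H → H ⪯ K → G ⪯ K)
    × (∀ G H → InF n G → InF n H → G ⪯ H → H ⪯ G → G ≡ H))
    × ((∀ (b : Vec Bool (n ∸ 2)) → InF n (G[_] {n} b))
    × (∀ (b b′ : Vec Bool (n ∸ 2)) → G[_] {n} b ≡ G[ b′ ] → b ≡ b′)
    × (∀ (G : Graph n) → InF n G → ∃[ b ] G[_] {n} b ≡ G)
    × (∀ (b b′ : Vec Bool (n ∸ 2)) → Pointwise B._≤_ b b′ ⇔ (G[_] {n} b ⪯ G[ b′ ])))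
corollary3p21 (suc (suc k)) (s≤s (s≤s z≤n)) =
  ( (λ _ _ → ε)
  , (λ _ _ _ _ _ _ G⪯H H⪯K → G⪯H ◅◅ H⪯K)
  , ⪯-antisym )
  , ( G-InF
    , G-injective
    , G-surjective
    , λ b b′ → mk⇔ G-monotone (G-reflects b b′) )
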